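{- Let $X$ be a finite set of variables, $Z,P\subseteq\mathbb{Q}[X]$ finite with $Z$ a Gröbner basis, $Y$ a finite set of variables disjoint from $X$, and $f:\mathbb{Q}[Y]\to\mathbb{Q}[X]$ a ring homomorphism. Then \[ \mathrm{alg.cone}_Y(\mathit{inverse\text{ - }hom}(Z,P,f,Y))=f^{ -1}(\mathrm{alg.cone}_X(Z,P)). \]
   Context: $\mathit{inverse\text{ - }hom}(Z,P,f,Y)=\mathit{project}_Y(\{y-f(y):y\in Y\}\cup Z,\ P)$, computed in $\mathbb{Q}[X\cup Y]$. For finite $Z,P\subseteq\mathbb{Q}[V]$, $\mathrm{alg.cone}_V(Z,P)=\langle Z\rangle_V+\mathrm{cone}(P)$ (ideal of $\mathbb{Q}[V]$ generated by $Z$ plus non-negative rational combinations of $P$). For $W\subseteq V$ and finite $Z,P\subseteq\mathbb{Q}[V]$, with a fixed monomial ordering $\preceq$: the elimination ordering $\preceq_W$ compares monomials $m=m_Wm_{\overline W}$, $n=n_Wn_{\overline W}$ (parts over $W$ and over $V\setminus W$) by $m\preceq_W n$ iff $m_{\overline W}\prec n_{\overline W}$, or $m_{\overline W}=n_{\overline W}$ and $m_W\preceq n_W$; $\mathit{project}_W(Z,P)=\langle G\cap\mathbb{Q}[W],\mathrm{proj}(\{\mathbf{red}_G(p):p\in P\},[W])\rangle$, where $G$ is a Gröbner basis of the ideal generated by $Z$ in $\mathbb{Q}[V]$ w.r.t. $\preceq_W$, $\mathbf{red}_G$ is normal form modulo $G$, $[W]$ the monomials over $W$, and $\mathrm{proj}(S,N)$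 a finite set with $\mathrm{cone}(\mathrm{proj}(S,N))=\mathrm{cone}(S)\cap\mathrm{span}_{\mathbb{Q}}(N)$. -}

module Defs where

open import Data.Nat as ℕ using (ℕ; zero; suc)
open import Data.Rational as ℚ using (ℚ; 0ℚ; 1ℚ)
open import Data.Fin using (Fin)
open import Data.Vec as Vec using (Vec; replicate; zipWith; updateAt; take; drop; _++_)
open import Data.Vec.Properties using (≡-dec)
open import Data.Vec.Relation.Binary.Pointwise.Inductive using (Pointwise)
open import Data.List as List using (List; []; _∷_; map; concatMap; foldr; allFin)
open import Data.List.Membership.Propositional using (_∈_)
open import Data.List.Relation.Unary.All using (All)
open import Data.Product using (Σ; ∃; ∃-syntax; _×_; _,_; proj₁; proj₂)
open import Data.Sum using (_⊎_)
open import Relation.Nullary using (¬_; yes; no)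
open import Relation.Binary.PropositionalEquality using (_≡_; _≢_)
open import Relation.Binary.Structures using (IsTotalOrder)
open import Function.Bundles using (_⇔_)

Mon : ℕ → Set
Mon n = Vec ℕ n

1ᵐ : ∀ {n} → Mon n
1ᵐ = replicate _ 0

_*ᵐ_ : ∀ {n} → Mon n → Mon n → Mon n
_*ᵐ_ = zipWith ℕ._+_

_∣ᵐ_ : ∀ {n} → Mon n → Mon n → Set
u ∣ᵐ v = Pointwise ℕ._≤_ u v

-- A polynomial is a finite list of terms (coefficient, monomial); it is
-- considered up to the semantic equality _≈_ (equal coefficients).
Poly : ℕ → Set
Poly n = List (ℚ × Mon n)

coeff : ∀ {n} → Poly n → Mon n → ℚ
coeff [] u = 0ℚ
coeff ((c , v) ∷ p) u with ≡-dec ℕ._≟_ v u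
... | yes _ = c ℚ.+ coeff p u
... | no  _ = coeff p u

_≈_ : ∀ {n} → Poly n → Poly n → Set
p ≈ q = ∀ u → coeff p u ≡ coeff q u

IsZero : ∀ {n} → Poly n → Set
IsZero p = ∀ u → coeff p u ≡ 0ℚ

InSupp : ∀ {n} → Mon n → Poly n → Set
InSupp u p = coeff p u ≢ 0ℚ

0ₚ : ∀ {n} → Poly n
0ₚ = []

1ₚ : ∀ {n} → Poly n
1ₚ = (1ℚ , 1ᵐ) ∷ []

const : ∀ {n} → ℚ → Poly n
const c = (c , 1ᵐ) ∷ []

var : ∀ {n} → Fin n → Poly n
var i = (1ℚ , updateAt 1ᵐ i (λ _ → 1)) ∷ []

_+ₚ_ : ∀ {n} → Poly n → Poly n → Poly n
p +ₚ q = p List.++ q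

-ₚ_ : ∀ {n} → Poly n → Poly n
-ₚ p = map (λ t → (ℚ.- proj₁ t , proj₂ t)) p

_-ₚ_ : ∀ {n} → Poly n → Poly n → Poly n
p -ₚ q = p +ₚ (-ₚ q)

_*ₚ_ : ∀ {n} → Poly n → Poly n → Poly n
p *ₚ q = concatMap (λ s → map (λ t → (proj₁ s ℚ.* proj₁ t , proj₂ s *ᵐ proj₂ t)) q) p

sumₚ : ∀ {n} → List (Poly n) → Poly n
sumₚ = foldr _+ₚ_ 0ₚ

PSet : ℕ → Set₁
PSet n = Poly n → Set

InIdeal : ∀ {n} → PSet n → PSet n
InIdeal {n} S p = Σ (List (Poly n × Poly n)) λ cs →
  All (λ t → S (proj₂ t)) cs × (p ≈ sumₚ (map (λ t → proj₁ t *ₚ proj₂ t) cs))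

InCone : ∀ {n} → PSet n → PSet n
InCone S p = Σ (List (ℚ × Poly _)) λ cs →
  All (λ t → (0ℚ ℚ.≤ proj₁ t) × S (proj₂ t)) cs
  × (p ≈ sumₚ (map (λ t → const (proj₁ t) *ₚ proj₂ t) cs))

AlgCone : ∀ {n} → PSet n → PSet n → PSet n
AlgCone Z P p = Σ (Poly _) λ a → Σ (Poly _) λ b →
  InIdeal Z a × InCone P b × (p ≈ (a +ₚ b))

listSet : ∀ {n} → List (Poly n) → PSet n
listSet L p = p ∈ L

record MonomialOrder (n : ℕ) : Set₁ where
  field
    _≼_         : Mon n → Mon n → Set
    isTotalOrder : IsTotalOrder _≡_ _≼_
    multiplicative : ∀ u v w → u ≼ v → (u *ᵐ w) ≼ (v *ᵐ w)
    one-least   : ∀ u → 1ᵐ ≼ u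

MonRel : ℕ → Set₁
MonRel n = Mon n → Mon n → Set

strict : ∀ {n} → MonRel n → MonRel n
strict _≼_ u v = (u ≼ v) × (u ≢ v)

IsLM : ∀ {n} → MonRel n → Poly n → Mon n → Set
IsLM _≼_ p lm = InSupp lm p × (∀ u → InSupp u p → u ≼ lm)

-- G is a Gröbner basis of the ideal ⟨S⟩ w.r.t. ≼:
-- G ⊆ ⟨S⟩ and ⟨LM(⟨S⟩)⟩ = ⟨LM(G)⟩
IsGroebnerOf : ∀ {n} → MonRel n → PSet n → List (Poly n) → Set
IsGroebnerOf _≼_ S G =
  All (InIdeal S) G ×
  (∀ p → InIdeal S p → ¬ IsZero p →
     ∃[ g ] ∃[ lp ] ∃[ lg ] (g ∈ G × IsLM _≼_ p lp × IsLM _≼_ g lg × lg ∣ᵐ lp))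

IsGroebner : ∀ {n} → MonRel n → List (Poly n) → Set
IsGroebner _≼_ Z = IsGroebnerOf _≼_ (listSet Z) Z

IsNormalForm : ∀ {n} → MonRel n → List (Poly n) → Poly n → Poly n → Set
IsNormalForm _≼_ G p r =
  InIdeal (listSet G) (p -ₚ r) ×
  (∀ g lg u → g ∈ G → IsLM _≼_ g lg → InSupp u r → ¬ (lg ∣ᵐ u))

-- Variables X = first m variables, Y = last k variables of X ∪ Y (m + k vars)

embXᵐ : ∀ {m} k → Mon m → Mon (m ℕ.+ k)
embXᵐ k u = u ++ replicate k 0

embYᵐ : ∀ m {k} → Mon k → Mon (m ℕ.+ k)
embYᵐ m v = replicate m 0 ++ v

embX : ∀ {m} k → Poly m → Poly (m ℕ.+ k)
embX k = map (λ t → (proj₁ t , embXᵐ k (proj₂ t)))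

embY : ∀ m {k} → Poly k → Poly (m ℕ.+ k)
embY m = map (λ t → (proj₁ t , embYᵐ m (proj₂ t)))

toY : ∀ m {k} → Poly (m ℕ.+ k) → Poly k
toY m = map (λ t → (proj₁ t , drop m (proj₂ t)))

InQY : ∀ m {k} → Poly (m ℕ.+ k) → Set
InQY m {k} p = ∀ u → InSupp u p → take m u ≡ replicate m 0

restrictX : ∀ {m k} → MonomialOrder (m ℕ.+ k) → MonRel m
restrictX {k = k} ord u v = embXᵐ k u ≼ embXᵐ k v
  where open MonomialOrder ord

elimY : ∀ m {k} → MonomialOrder (m ℕ.+ k) → MonRel (m ℕ.+ k)
elimY m {k} ord u v =
  strict _≼_ (embXᵐ k (take m u)) (embXᵐ k (take m v))
  ⊎ (take m u ≡ take m v × embYᵐ m (drop m u) ≼ embYᵐ m (drop m v))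
  where open MonomialOrder ord

IsProj : ∀ {n} → PSet n → PSet n → List (Poly n) → Set
IsProj S span Q = ∀ q → InCone (listSet Q) q ⇔ (InCone S q × span q)

record IsRingHom {k m} (f : Poly k → Poly m) : Set where
  field
    cong-≈ : ∀ p q → p ≈ q → f p ≈ f q
    hom-+  : ∀ p q → f (p +ₚ q) ≈ (f p +ₚ f q)
    hom-*  : ∀ p q → f (p *ₚ q) ≈ (f p *ₚ f q)
    hom-1  : f 1ₚ ≈ 1ₚ

invHomGens : ∀ m k → (Poly k → Poly m) → List (Poly m) → List (Poly (m ℕ.+ k))
invHomGens m k f Z =
  map (λ y → embY m (var y) -ₚ embX k (f (var y))) (allFin k) List.++ map (embX k) Z

GroebnerY : ∀ m {k} → List (Poly (m ℕ.+ k)) → PSet k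
GroebnerY m G q = ∃[ g ] (g ∈ G × InQY m g × q ≡ toY m g)

module Submission where

-- Let I = ⟨{y - f(y)} ∪ Z⟩ ⊆ ℚ[X ∪ Y] and let σ : ℚ[X ∪ Y] → ℚ[X] substitute f(y) for y.
-- Then σ(I) ⊆ ⟨Z⟩, σ agrees with f on ℚ[Y], and p ≡ σ(p) (mod I) for every p.
-- Forward: σ maps each element of R, which is ≡ some p ∈ P (mod I), into alg.cone(Z,P),
-- hence f maps alg.cone_Y(G ∩ ℚ[Y], Q) there too.
-- Backward: if f(q) = a + b with a ∈ ⟨Z⟩ and b ∈ cone(P), then q ≡ b ≡ s (mod I) for some
-- s ∈ cone(R) in normal form.  Reducing q by G ∩ ℚ[Y] (terminating by Dickson's lemma)
-- yields r ∈ ℚ[Y] in normal form with q - r ∈ ⟨G ∩ ℚ[Y]⟩; as G is a Gröbner basis of I,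
-- r = s, so r ∈ cone(R) ∩ ℚ[Y] = cone(Q).

open import Defs
open import Algebra.Bundles using (CommutativeRing)
open import Algebra.Structures using (IsCommutativeRing)
open import Algebra.Solver.Ring.AlmostCommutativeRing using (AlmostCommutativeRing; fromCommutativeRing; _-Raw-AlmostCommutative⟶_)
import Algebra.Solver.Ring as RingSolver
open import Data.Empty using (⊥; ⊥-elim)
open import Data.Fin using (Fin; zero; suc)
open import Data.Integer as ℤ using (ℤ; +_; -[1+_])
import Data.Integer.Properties as ℤP
import Data.Integer.Solver as ℤ-Solver
open import Data.List as L using (List; []; _∷_; length; map; allFin)
import Data.List.Properties as LP
open import Data.List.Membership.Propositional using (_∈_; find; lose)
open import Data.List.Membership.Propositional.Properties using (∈-map⁺; ∈-map⁻; ∈-++⁺ˡ; ∈-++⁺ʳ; ∈-++⁻; ∈-allFin; ∈-filter⁺; ∈-filter⁻)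
open import Data.List.Relation.Binary.Pointwise using (Pointwise; []; _∷_)
open import Data.List.Relation.Unary.All as All using (All; []; _∷_)
import Data.List.Relation.Unary.All.Properties as AllP
open import Data.List.Relation.Unary.Any using (here; there; any?)
open import Data.Maybe using (Maybe; nothing; just)
open import Data.Nat as ℕ using (ℕ; zero; suc; _+_; _≤_; _<_; z≤n; s≤s)
import Data.Nat.Properties as ℕP
open import Data.Nat.Induction using (<-rec)
open import Data.Product using (∃-syntax; _×_; _,_; proj₁; proj₂)
open import Data.Rational as ℚ using (ℚ; 0ℚ; 1ℚ; mkℚ; toℚᵘ)
  renaming (_+_ to _+ℚ_; _*_ to _*ℚ_; -_ to -ℚ_)
import Data.Rational.Properties as ℚP
import Data.Rational.Solver as ℚ-Solver
open import Data.Rational.Unnormalised as ℚᵘ using (mkℚᵘ; *≡*)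
import Data.Rational.Unnormalised.Properties as ℚᵘP
open import Data.Sum using (_⊎_; inj₁; inj₂; [_,_]′)
open import Data.Unit using (⊤; tt)
open import Data.Vec as V using (Vec; []; _∷_; replicate; take; drop; _++_)
import Data.Vec.Properties as VP
open import Data.Vec.Relation.Binary.Pointwise.Inductive as PW using ([]; _∷_)
open import Function using (_∘_)
open import Function.Bundles using (_⇔_; mk⇔; Equivalence)
open import Induction.WellFounded using (Acc; acc)
open import Relation.Binary.PropositionalEquality
open import Relation.Binary.Definitions using (DecidableEquality)
open import Relation.Binary.Structures using (IsTotalOrder)
open import Relation.Nullary using (¬_; Dec; yes; no; ¬?)
open import Relation.Nullary.Decidable using (decidable-stable; _×-dec_)
open import Relation.Unary using (Decidable)

_≟ᵐ_ : ∀ {n} → DecidableEquality (Mon n)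
_≟ᵐ_ = VP.≡-dec ℕ._≟_

*ᵐ-comm : ∀ {n} (u v : Mon n) → u *ᵐ v ≡ v *ᵐ u
*ᵐ-comm = VP.zipWith-comm ℕP.+-comm

*ᵐ-assoc : ∀ {n} (u v w : Mon n) → (u *ᵐ v) *ᵐ w ≡ u *ᵐ (v *ᵐ w)
*ᵐ-assoc = VP.zipWith-assoc ℕP.+-assoc

*ᵐ-identityˡ : ∀ {n} (u : Mon n) → 1ᵐ *ᵐ u ≡ u
*ᵐ-identityˡ = VP.zipWith-identityˡ ℕP.+-identityˡ

*ᵐ-identityʳ : ∀ {n} (u : Mon n) → u *ᵐ 1ᵐ ≡ u
*ᵐ-identityʳ = VP.zipWith-identityʳ ℕP.+-identityʳ

δ : ∀ {n} → Mon n → Mon n → ℚ → ℚ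
δ v u c with v ≟ᵐ u
... | yes _ = c
... | no _ = 0ℚ

δ-≡ : ∀ {n} (u : Mon n) c → δ u u c ≡ c
δ-≡ u c with u ≟ᵐ u
... | yes _ = refl
... | no u≢u = ⊥-elim (u≢u refl)

δ-≢ : ∀ {n} {v u : Mon n} c → v ≢ u → δ v u c ≡ 0ℚ
δ-≢ {v = v} {u} c v≢u with v ≟ᵐ u
... | yes v≡u = ⊥-elim (v≢u v≡u)
... | no _ = refl

δ-scale : ∀ {n} (v u : Mon n) c → δ v u c ≡ c *ℚ δ v u 1ℚ
δ-scale v u c with v ≟ᵐ u
... | yes _ = sym (ℚP.*-identityʳ c)
... | no _ = sym (ℚP.*-zeroʳ c)

coeff-∷ : ∀ {n} c v (p : Poly n) u → coeff ((c , v) ∷ p) u ≡ δ v u c +ℚ coeff p u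
coeff-∷ c v p u with v ≟ᵐ u
... | yes _ = refl
... | no _ = sym (ℚP.+-identityˡ _)

-- Every equation between polynomials is proved by pairing both sides with an
-- arbitrary functional F on monomials: p ≈ q iff all pairings of p and q agree.
pair : ∀ {n} → (Mon n → ℚ) → Poly n → ℚ
pair F [] = 0ℚ
pair F ((c , v) ∷ p) = c *ℚ F v +ℚ pair F p

indicator : ∀ {n} → Mon n → Mon n → ℚ
indicator u v = δ v u 1ℚ

coeff≡pair : ∀ {n} (p : Poly n) u → coeff p u ≡ pair (indicator u) p
coeff≡pair [] u = refl
coeff≡pair ((c , v) ∷ p) u = trans (coeff-∷ c v p u) (cong₂ _+ℚ_ (δ-scale v u c) (coeff≡pair p u))

removeMon : ∀ {n} → Mon n → Poly n → Poly n
removeMon u [] = []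
removeMon u ((c , v) ∷ p) with v ≟ᵐ u
... | yes _ = removeMon u p
... | no _ = (c , v) ∷ removeMon u p

pair-removeMon : ∀ {n} F u (p : Poly n) → pair F p ≡ coeff p u *ℚ F u +ℚ pair F (removeMon u p)
pair-removeMon F u [] = sym (trans (ℚP.+-identityʳ _) (ℚP.*-zeroˡ (F u)))
pair-removeMon F u ((c , v) ∷ p) with v ≟ᵐ u | pair-removeMon F u p
... | yes refl | ih = trans (cong (c *ℚ F v +ℚ_) ih)
  (solve 4 (λ c a x r → c :* x :+ (a :* x :+ r) := (c :+ a) :* x :+ r) refl c (coeff p v) (F v) (pair F (removeMon v p)))
  where open ℚ-Solver.+-*-Solver
... | no _ | ih = trans (cong (c *ℚ F v +ℚ_) ih)
  (solve 3 (λ a b x → a :+ (b :+ x) := b :+ (a :+ x)) refl (c *ℚ F v) (coeff p u *ℚ F u) (pair F (removeMon u p)))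
  where open ℚ-Solver.+-*-Solver

coeff-removeMon-≡ : ∀ {n} u (p : Poly n) → coeff (removeMon u p) u ≡ 0ℚ
coeff-removeMon-≡ u [] = refl
coeff-removeMon-≡ u ((c , v) ∷ p) with v ≟ᵐ u
... | yes _ = coeff-removeMon-≡ u p
... | no v≢u = trans (coeff-∷ c v _ u) (trans (cong₂ _+ℚ_ (δ-≢ c v≢u) (coeff-removeMon-≡ u p)) (ℚP.+-identityˡ 0ℚ))

coeff-removeMon-≢ : ∀ {n} u (p : Poly n) {w} → w ≢ u → coeff (removeMon u p) w ≡ coeff p w
coeff-removeMon-≢ u [] w≢u = refl
coeff-removeMon-≢ u ((c , v) ∷ p) {w} w≢u with v ≟ᵐ u
... | yes refl = trans (coeff-removeMon-≢ u p w≢u)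
                   (trans (sym (ℚP.+-identityˡ _)) (trans (cong (_+ℚ coeff p w) (sym (δ-≢ c (w≢u ∘ sym)))) (sym (coeff-∷ c v p w))))
... | no _ = trans (coeff-∷ c v _ w) (trans (cong (δ v w c +ℚ_) (coeff-removeMon-≢ u p w≢u)) (sym (coeff-∷ c v p w)))

length-removeMon : ∀ {n} u (p : Poly n) → length (removeMon u p) ≤ length p
length-removeMon u [] = z≤n
length-removeMon u ((c , v) ∷ p) with v ≟ᵐ u
... | yes _ = ℕP.m≤n⇒m≤1+n (length-removeMon u p)
... | no _ = s≤s (length-removeMon u p)

length-removeMon-head : ∀ {n} c u (p : Poly n) → length (removeMon u ((c , u) ∷ p)) < length ((c , u) ∷ p)
length-removeMon-head c u p with u ≟ᵐ u
... | yes _ = s≤s (length-removeMon u p)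
... | no u≢u = ⊥-elim (u≢u refl)

pair-vanishes : ∀ {n} (K : Mon n → ℚ) (p : Poly n) → (∀ u → InSupp u p → K u ≡ 0ℚ) → pair K p ≡ 0ℚ
pair-vanishes {n} K p = <-rec (λ l → ∀ p → length p ≡ l → Vanishes p → pair K p ≡ 0ℚ) step (length p) p refl
  where
  Vanishes : Poly n → Set
  Vanishes p = ∀ u → InSupp u p → K u ≡ 0ℚ
  step : ∀ l → (∀ {l′} → l′ < l → ∀ p → length p ≡ l′ → Vanishes p → pair K p ≡ 0ℚ) →
         ∀ p → length p ≡ l → Vanishes p → pair K p ≡ 0ℚ
  step l ih [] _ _ = refl
  step l ih p@((c , u) ∷ p′) refl h = begin
    pair K p                                            ≡⟨ pair-removeMon K u p ⟩
    coeff p u *ℚ K u +ℚ pair K (removeMon u p)          ≡⟨ cong₂ _+ℚ_ headTerm (ih (length-removeMon-head c u p′) (removeMon u p) refl rest) ⟩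
    0ℚ +ℚ 0ℚ                                            ≡⟨ ℚP.+-identityˡ 0ℚ ⟩
    0ℚ                                                  ∎
    where
    open ≡-Reasoning
    headTerm : coeff p u *ℚ K u ≡ 0ℚ
    headTerm with coeff p u ℚ.≟ 0ℚ
    ... | yes pu≡0 = trans (cong (_*ℚ K u) pu≡0) (ℚP.*-zeroˡ (K u))
    ... | no pu≢0 = trans (cong (coeff p u *ℚ_) (h u pu≢0)) (ℚP.*-zeroʳ (coeff p u))
    rest : Vanishes (removeMon u p)
    rest w sw with w ≟ᵐ u
    ... | yes refl = ⊥-elim (sw (coeff-removeMon-≡ u p))
    ... | no w≢u = h w (λ pw≡0 → sw (trans (coeff-removeMon-≢ u p w≢u) pw≡0))

pair-++ : ∀ {n} F (p q : Poly n) → pair F (p L.++ q) ≡ pair F p +ℚ pair F q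
pair-++ F [] q = sym (ℚP.+-identityˡ _)
pair-++ F ((c , v) ∷ p) q = trans (cong (c *ℚ F v +ℚ_) (pair-++ F p q)) (sym (ℚP.+-assoc (c *ℚ F v) (pair F p) (pair F q)))

pair-neg : ∀ {n} F (p : Poly n) → pair F (-ₚ p) ≡ -ℚ pair F p
pair-neg F [] = refl
pair-neg F ((c , v) ∷ p) = trans (cong₂ _+ℚ_ (sym (ℚP.neg-distribˡ-* c (F v))) (pair-neg F p))
  (sym (ℚP.neg-distrib-+ (c *ℚ F v) (pair F p)))

pair-- : ∀ {n} F (p q : Poly n) → pair F (p -ₚ q) ≡ pair F p +ℚ -ℚ pair F q
pair-- F p q = trans (pair-++ F p (-ₚ q)) (cong (pair F p +ℚ_) (pair-neg F q))

pair-ext : ∀ {n} {F G : Mon n → ℚ} (p : Poly n) → (∀ v → F v ≡ G v) → pair F p ≡ pair G p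
pair-ext [] e = refl
pair-ext ((c , v) ∷ p) e = cong₂ _+ℚ_ (cong (c *ℚ_) (e v)) (pair-ext p e)

pair-zeroˡ : ∀ {n} (p : Poly n) → pair (λ _ → 0ℚ) p ≡ 0ℚ
pair-zeroˡ p = pair-vanishes _ p (λ _ _ → refl)

pair-*ˡ : ∀ {n} c F (p : Poly n) → pair (λ v → c *ℚ F v) p ≡ c *ℚ pair F p
pair-*ˡ c F [] = sym (ℚP.*-zeroʳ c)
pair-*ˡ c F ((d , v) ∷ p) = trans (cong₂ _+ℚ_ (solve 3 (λ c d x → d :* (c :* x) := c :* (d :* x)) refl c d (F v)) (pair-*ˡ c F p))
  (sym (ℚP.*-distribˡ-+ c (d *ℚ F v) (pair F p)))
  where open ℚ-Solver.+-*-Solver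

pair-+ˡ : ∀ {n} F G (p : Poly n) → pair (λ v → F v +ℚ G v) p ≡ pair F p +ℚ pair G p
pair-+ˡ F G [] = sym (ℚP.+-identityˡ 0ℚ)
pair-+ˡ F G ((d , v) ∷ p) = trans (cong (d *ℚ (F v +ℚ G v) +ℚ_) (pair-+ˡ F G p))
  (solve 5 (λ d x y a b → d :* (x :+ y) :+ (a :+ b) := (d :* x :+ a) :+ (d :* y :+ b)) refl d (F v) (G v) (pair F p) (pair G p))
  where open ℚ-Solver.+-*-Solver

pair-negˡ : ∀ {n} (G : Mon n → ℚ) p → pair (λ v → -ℚ G v) p ≡ -ℚ pair G p
pair-negˡ G [] = refl
pair-negˡ G ((c , v) ∷ p) = trans (cong₂ _+ℚ_ (sym (ℚP.neg-distribʳ-* c (G v))) (pair-negˡ G p)) (sym (ℚP.neg-distrib-+ (c *ℚ G v) (pair G p)))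

pair-swap : ∀ {n k} (G : Mon n → Mon k → ℚ) (p : Poly n) (q : Poly k) →
  pair (λ v → pair (λ w → G v w) q) p ≡ pair (λ w → pair (λ v → G v w) p) q
pair-swap G [] q = sym (pair-zeroˡ q)
pair-swap G ((c , v) ∷ p) q = trans (cong₂ _+ℚ_ (sym (pair-*ˡ c (G v) q)) (pair-swap G p q))
  (sym (pair-+ˡ (λ w → c *ℚ G v w) (λ w → pair (λ v₁ → G v₁ w) p) q))

pair-supp : ∀ {n} (F G : Mon n → ℚ) (p : Poly n) → (∀ u → InSupp u p → F u ≡ G u) → pair F p ≡ pair G p
pair-supp F G p h = begin
  pair F p                                       ≡⟨ solve 2 (λ a b → a := (a :+ (:- b)) :+ b) refl (pair F p) (pair G p) ⟩
  (pair F p +ℚ -ℚ pair G p) +ℚ pair G p          ≡⟨ cong (_+ℚ pair G p) (sym (trans (pair-+ˡ F _ p) (cong (pair F p +ℚ_) (pair-negˡ G p)))) ⟩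
  pair (λ v → F v +ℚ -ℚ G v) p +ℚ pair G p       ≡⟨ cong (_+ℚ pair G p) (pair-vanishes _ p F≡G) ⟩
  0ℚ +ℚ pair G p                                 ≡⟨ ℚP.+-identityˡ _ ⟩
  pair G p                                       ∎
  where
  open ≡-Reasoning
  open ℚ-Solver.+-*-Solver
  F≡G : ∀ u → InSupp u p → F u +ℚ -ℚ G u ≡ 0ℚ
  F≡G u s = trans (cong (_+ℚ -ℚ G u) (h u s)) (ℚP.+-inverseʳ (G u))

pair-mapMon : ∀ {n k} F (φ : Mon n → Mon k) (p : Poly n) → pair F (map (λ t → (proj₁ t , φ (proj₂ t))) p) ≡ pair (F ∘ φ) p
pair-mapMon F φ [] = refl
pair-mapMon F φ ((c , v) ∷ p) = cong (c *ℚ F (φ v) +ℚ_) (pair-mapMon F φ p)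

pair-*ₚ : ∀ {n} F (p q : Poly n) → pair F (p *ₚ q) ≡ pair (λ v → pair (λ w → F (v *ᵐ w)) q) p
pair-*ₚ F [] q = refl
pair-*ₚ F ((c , v) ∷ p) q = trans (pair-++ F (map (λ t → (c *ℚ proj₁ t , v *ᵐ proj₂ t)) q) (p *ₚ q)) (cong₂ _+ℚ_ (term c v q) (pair-*ₚ F p q))
  where
  term : ∀ c v q → pair F (map (λ t → (c *ℚ proj₁ t , v *ᵐ proj₂ t)) q) ≡ c *ℚ pair (λ w → F (v *ᵐ w)) q
  term c v [] = sym (ℚP.*-zeroʳ c)
  term c v ((d , w) ∷ q) = trans (cong₂ _+ℚ_ (ℚP.*-assoc c d (F (v *ᵐ w))) (term c v q))
    (sym (ℚP.*-distribˡ-+ c (d *ℚ F (v *ᵐ w)) _))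

≈-byPairing : ∀ {n} {p q : Poly n} → (∀ F → pair F p ≡ pair F q) → p ≈ q
≈-byPairing {p = p} {q} h u = trans (coeff≡pair p u) (trans (h (indicator u)) (sym (coeff≡pair q u)))

pair-≈ : ∀ {n} F {p q : Poly n} → p ≈ q → pair F p ≡ pair F q
pair-≈ F {p} {q} p≈q = begin
  pair F p                              ≡⟨ solve 2 (λ a b → a := (a :+ (:- b)) :+ b) refl (pair F p) (pair F q) ⟩
  (pair F p +ℚ -ℚ pair F q) +ℚ pair F q ≡⟨ cong (_+ℚ pair F q) (sym (pair-- F p q)) ⟩
  pair F (p -ₚ q) +ℚ pair F q           ≡⟨ cong (_+ℚ pair F q) (pair-vanishes F (p -ₚ q) (λ u s → ⊥-elim (s (difference-zero u)))) ⟩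
  0ℚ +ℚ pair F q                        ≡⟨ ℚP.+-identityˡ _ ⟩
  pair F q                              ∎
  where
  open ≡-Reasoning
  open ℚ-Solver.+-*-Solver
  difference-zero : IsZero (p -ₚ q)
  difference-zero u = begin
    coeff (p -ₚ q) u                 ≡⟨ coeff≡pair (p -ₚ q) u ⟩
    pair (indicator u) (p -ₚ q)      ≡⟨ pair-- (indicator u) p q ⟩
    pair (indicator u) p +ℚ -ℚ pair (indicator u) q ≡⟨ cong₂ (λ a b → a +ℚ -ℚ b) (sym (coeff≡pair p u)) (sym (coeff≡pair q u)) ⟩
    coeff p u +ℚ -ℚ coeff q u        ≡⟨ cong (λ a → coeff p u +ℚ -ℚ a) (sym (p≈q u)) ⟩
    coeff p u +ℚ -ℚ coeff p u        ≡⟨ ℚP.+-inverseʳ (coeff p u) ⟩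
    0ℚ                               ∎

-- A record wrapper around _≈_, whose arguments Agda cannot infer from a pointwise function type.
record _≋_ {n : ℕ} (p q : Poly n) : Set where
  constructor mk≋
  field get : p ≈ q
open _≋_ public
infix 4 _≋_

module _ {n : ℕ} where
  private
    P : Set
    P = Poly n

  ≋-byPairing : ∀ {p q : P} → (∀ F → pair F p ≡ pair F q) → p ≋ q
  ≋-byPairing {p} {q} h = mk≋ (≈-byPairing {p = p} {q = q} h)

  pair-cong : ∀ F {p q : P} → p ≋ q → pair F p ≡ pair F q
  pair-cong F {p} {q} (mk≋ e) = pair-≈ F {p} {q} e

  ≋-refl : ∀ {p : P} → p ≋ p
  ≋-refl = mk≋ (λ u → refl)

  ≋-sym : ∀ {p q : P} → p ≋ q → q ≋ p
  ≋-sym (mk≋ e) = mk≋ (λ u → sym (e u))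

  ≋-trans : ∀ {p q r : P} → p ≋ q → q ≋ r → p ≋ r
  ≋-trans (mk≋ e) (mk≋ f) = mk≋ (λ u → trans (e u) (f u))

  ≋-reflexive : ∀ {p q : P} → p ≡ q → p ≋ q
  ≋-reflexive refl = ≋-refl

  +ₚ-cong : ∀ {p p′ q q′ : P} → p ≋ p′ → q ≋ q′ → (p +ₚ q) ≋ (p′ +ₚ q′)
  +ₚ-cong {p} {p′} {q} {q′} e f = ≋-byPairing λ F →
    trans (pair-++ F p q) (trans (cong₂ _+ℚ_ (pair-cong F e) (pair-cong F f)) (sym (pair-++ F p′ q′)))

  +ₚ-assoc : ∀ (p q r : P) → ((p +ₚ q) +ₚ r) ≋ (p +ₚ (q +ₚ r))
  +ₚ-assoc p q r = ≋-reflexive (LP.++-assoc p q r)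

  +ₚ-comm : ∀ (p q : P) → (p +ₚ q) ≋ (q +ₚ p)
  +ₚ-comm p q = ≋-byPairing λ F → trans (pair-++ F p q) (trans (ℚP.+-comm (pair F p) (pair F q)) (sym (pair-++ F q p)))

  +ₚ-identityˡ : ∀ (p : P) → (0ₚ +ₚ p) ≋ p
  +ₚ-identityˡ p = ≋-refl

  +ₚ-identityʳ : ∀ (p : P) → (p +ₚ 0ₚ) ≋ p
  +ₚ-identityʳ p = ≋-reflexive (LP.++-identityʳ p)

  -ₚ-cong : ∀ {p q : P} → p ≋ q → (-ₚ p) ≋ (-ₚ q)
  -ₚ-cong {p} {q} e = ≋-byPairing λ F → trans (pair-neg F p) (trans (cong -ℚ_ (pair-cong F e)) (sym (pair-neg F q)))

  -ₚ-inverseˡ : ∀ (p : P) → ((-ₚ p) +ₚ p) ≋ 0ₚ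
  -ₚ-inverseˡ p = ≋-byPairing λ F → trans (pair-++ F (-ₚ p) p) (trans (cong (_+ℚ pair F p) (pair-neg F p)) (ℚP.+-inverseˡ (pair F p)))

  -ₚ-inverseʳ : ∀ (p : P) → (p -ₚ p) ≋ 0ₚ
  -ₚ-inverseʳ p = ≋-byPairing λ F → trans (pair-- F p p) (ℚP.+-inverseʳ (pair F p))

  *ₚ-cong : ∀ {p p′ q q′ : P} → p ≋ p′ → q ≋ q′ → (p *ₚ q) ≋ (p′ *ₚ q′)
  *ₚ-cong {p} {p′} {q} {q′} e f = ≋-byPairing λ F →
    trans (pair-*ₚ F p q) (trans (pair-cong _ e) (trans (pair-ext p′ (λ v → pair-cong (λ w → F (v *ᵐ w)) f)) (sym (pair-*ₚ F p′ q′))))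

  *ₚ-assoc : ∀ (p q r : P) → ((p *ₚ q) *ₚ r) ≋ (p *ₚ (q *ₚ r))
  *ₚ-assoc p q r = ≋-byPairing λ F →
    trans (pair-*ₚ F (p *ₚ q) r) (trans (pair-*ₚ _ p q)
     (sym (trans (pair-*ₚ F p (q *ₚ r))
       (pair-ext p (λ v → trans (pair-*ₚ _ q r) (pair-ext q (λ w → pair-ext r (λ x → cong F (sym (*ᵐ-assoc v w x))))))))))

  *ₚ-comm : ∀ (p q : P) → (p *ₚ q) ≋ (q *ₚ p)
  *ₚ-comm p q = ≋-byPairing λ F →
    trans (pair-*ₚ F p q) (trans (pair-swap (λ v w → F (v *ᵐ w)) p q)
      (trans (pair-ext q (λ w → pair-ext p (λ v → cong F (*ᵐ-comm v w)))) (sym (pair-*ₚ F q p))))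

  *ₚ-identityˡ : ∀ (p : P) → (1ₚ *ₚ p) ≋ p
  *ₚ-identityˡ p = ≋-byPairing λ F →
    trans (pair-*ₚ F 1ₚ p) (trans (ℚP.+-identityʳ _) (trans (ℚP.*-identityˡ _) (pair-ext p (λ w → cong F (*ᵐ-identityˡ w)))))

  *ₚ-identityʳ : ∀ (p : P) → (p *ₚ 1ₚ) ≋ p
  *ₚ-identityʳ p = ≋-trans (*ₚ-comm p 1ₚ) (*ₚ-identityˡ p)

  *ₚ-distribʳ : ∀ (r p q : P) → ((p +ₚ q) *ₚ r) ≋ ((p *ₚ r) +ₚ (q *ₚ r))
  *ₚ-distribʳ r p q = ≋-byPairing λ F →
    trans (pair-*ₚ F (p +ₚ q) r) (trans (pair-++ _ p q) (sym (trans (pair-++ F (p *ₚ r) (q *ₚ r)) (cong₂ _+ℚ_ (pair-*ₚ F p r) (pair-*ₚ F q r)))))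

  *ₚ-distribˡ : ∀ (r p q : P) → (r *ₚ (p +ₚ q)) ≋ ((r *ₚ p) +ₚ (r *ₚ q))
  *ₚ-distribˡ r p q = ≋-byPairing λ F →
    trans (pair-*ₚ F r (p +ₚ q)) (trans (pair-ext r (λ v → pair-++ _ p q)) (trans (pair-+ˡ _ _ r)
      (sym (trans (pair-++ F (r *ₚ p) (r *ₚ q)) (cong₂ _+ℚ_ (pair-*ₚ F r p) (pair-*ₚ F r q))))))

  isCommutativeRing : IsCommutativeRing (_≋_ {n}) _+ₚ_ _*ₚ_ -ₚ_ 0ₚ 1ₚ
  isCommutativeRing = record
    { isRing = record
      { +-isAbelianGroup = record
        { isGroup = record
          { isMonoid = record
            { isSemigroup = record
              { isMagma = record { isEquivalence = record { refl = ≋-refl ; sym = ≋-sym ; trans = ≋-trans } ; ∙-cong = +ₚ-cong }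
              ; assoc = +ₚ-assoc }
            ; identity = +ₚ-identityˡ , +ₚ-identityʳ }
          ; inverse = -ₚ-inverseˡ , -ₚ-inverseʳ
          ; ⁻¹-cong = -ₚ-cong }
        ; comm = +ₚ-comm }
      ; *-cong = *ₚ-cong
      ; *-assoc = *ₚ-assoc
      ; *-identity = *ₚ-identityˡ , *ₚ-identityʳ
      ; distrib = *ₚ-distribˡ , *ₚ-distribʳ }
    ; *-comm = *ₚ-comm }

  const-+ : ∀ a b → const {n} (a +ℚ b) ≋ (const a +ₚ const b)
  const-+ a b = ≋-byPairing λ F → trans (ℚP.+-identityʳ _)
     (solve 3 (λ a b x → (a :+ b) :* x := a :* x :+ (b :* x :+ con 0ℚ)) refl a b (F 1ᵐ))
    where open ℚ-Solver.+-*-Solver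

  const-* : ∀ a b → const {n} (a *ℚ b) ≋ (const a *ₚ const b)
  const-* a b = ≋-byPairing λ F → trans (ℚP.+-identityʳ _)
     (trans (cong (λ u → (a *ℚ b) *ℚ F u) (sym (*ᵐ-identityˡ 1ᵐ))) (sym (ℚP.+-identityʳ _)))

  const-0 : const {n} 0ℚ ≋ 0ₚ
  const-0 = ≋-byPairing λ F → trans (ℚP.+-identityʳ (0ℚ *ℚ F 1ᵐ)) (ℚP.*-zeroˡ (F 1ᵐ))

PolyRing : ℕ → CommutativeRing _ _
PolyRing n = record { isCommutativeRing = isCommutativeRing {n} }

module PolySolver (n : ℕ) where
  private
    ACR : AlmostCommutativeRing _ _
    ACR = fromCommutativeRing (PolyRing n)
    morphism : ℚ.+-*-rawRing -Raw-AlmostCommutative⟶ ACR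
    morphism = record { ⟦_⟧ = const ; +-homo = const-+ ; *-homo = const-* ; -‿homo = λ _ → ≋-refl ; 0-homo = const-0 ; 1-homo = ≋-refl }
    const-≟ : ∀ a b → Maybe (const {n} a ≋ const b)
    const-≟ a b with a ℚ.≟ b
    ... | yes refl = just ≋-refl
    ... | no _ = nothing
  open RingSolver ℚ.+-*-rawRing ACR morphism const-≟ public hiding (var)

module _ {n : ℕ} where
  private
    P : Set
    P = Poly n

  sumₚ-++ : ∀ (xs ys : List P) → sumₚ (xs L.++ ys) ≋ (sumₚ xs +ₚ sumₚ ys)
  sumₚ-++ [] ys = ≋-refl
  sumₚ-++ (x ∷ xs) ys = ≋-trans (+ₚ-cong (≋-refl {p = x}) (sumₚ-++ xs ys)) (≋-sym (+ₚ-assoc x (sumₚ xs) (sumₚ ys)))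

  idealSum : List (P × P) → P
  idealSum cs = sumₚ (map (λ t → proj₁ t *ₚ proj₂ t) cs)

  coneSum : List (ℚ × P) → P
  coneSum cs = sumₚ (map (λ t → const (proj₁ t) *ₚ proj₂ t) cs)

  idealSum-++ : ∀ cs ds → idealSum (cs L.++ ds) ≋ (idealSum cs +ₚ idealSum ds)
  idealSum-++ cs ds = ≋-trans (≋-reflexive (cong sumₚ (LP.map-++ _ cs ds))) (sumₚ-++ (map _ cs) (map _ ds))

  coneSum-++ : ∀ cs ds → coneSum (cs L.++ ds) ≋ (coneSum cs +ₚ coneSum ds)
  coneSum-++ cs ds = ≋-trans (≋-reflexive (cong sumₚ (LP.map-++ _ cs ds))) (sumₚ-++ (map _ cs) (map _ ds))

record Ideal {n} (S : PSet n) (p : Poly n) : Set where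
  constructor mkIdeal
  field
    terms : List (Poly n × Poly n)
    generators : All (λ t → S (proj₂ t)) terms
    equation : p ≋ idealSum terms

record Cone {n} (S : PSet n) (p : Poly n) : Set where
  constructor mkCone
  field
    terms : List (ℚ × Poly n)
    generators : All (λ t → (0ℚ ℚ.≤ proj₁ t) × S (proj₂ t)) terms
    equation : p ≋ coneSum terms

module _ {n} {S : PSet n} {p : Poly n} where
  InIdeal⇒Ideal : InIdeal S p → Ideal S p
  InIdeal⇒Ideal (cs , a , e) = mkIdeal cs a (mk≋ {p = p} {q = idealSum cs} e)

  Ideal⇒InIdeal : Ideal S p → InIdeal S p
  Ideal⇒InIdeal (mkIdeal cs a e) = cs , a , get e

  InCone⇒Cone : InCone S p → Cone S p
  InCone⇒Cone (cs , a , e) = mkCone cs a (mk≋ {p = p} {q = coneSum cs} e)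

  Cone⇒InCone : Cone S p → InCone S p
  Cone⇒InCone (mkCone cs a e) = cs , a , get e

record IdealClosed {n} (Q : Poly n → Set) : Set where
  field
    closed-≋ : ∀ {p q} → p ≋ q → Q p → Q q
    closed-0 : Q 0ₚ
    closed-+ : ∀ {p q} → Q p → Q q → Q (p +ₚ q)
    closed-* : ∀ r {p} → Q p → Q (r *ₚ p)

record ConeClosed {n} (Q : Poly n → Set) : Set where
  field
    closed-≋ : ∀ {p q} → p ≋ q → Q p → Q q
    closed-0 : Q 0ₚ
    closed-+ : ∀ {p q} → Q p → Q q → Q (p +ₚ q)
    closed-scale : ∀ c → 0ℚ ℚ.≤ c → ∀ {p} → Q p → Q (const c *ₚ p)

Ideal-ind : ∀ {n} {S : PSet n} {Q : Poly n → Set} → IdealClosed Q → (∀ {g} → S g → Q g) → ∀ {p} → Ideal S p → Q p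
Ideal-ind {S = S} {Q} closed base (mkIdeal cs gens e) = closed-≋ (≋-sym e) (go cs gens)
  where
  open IdealClosed closed
  go : ∀ cs → All (λ t → S (proj₂ t)) cs → Q (idealSum cs)
  go [] [] = closed-0
  go ((c , g) ∷ cs) (s ∷ gens) = closed-+ (closed-* c (base s)) (go cs gens)

Cone-ind : ∀ {n} {S : PSet n} {Q : Poly n → Set} → ConeClosed Q → (∀ {g} → S g → Q g) → ∀ {p} → Cone S p → Q p
Cone-ind {S = S} {Q} closed base (mkCone cs gens e) = closed-≋ (≋-sym e) (go cs gens)
  where
  open ConeClosed closed
  go : ∀ cs → All (λ t → (0ℚ ℚ.≤ proj₁ t) × S (proj₂ t)) cs → Q (coneSum cs)
  go [] [] = closed-0
  go ((c , g) ∷ cs) ((c≥0 , s) ∷ gens) = closed-+ (closed-scale c c≥0 (base s)) (go cs gens)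

module _ {n : ℕ} {S : PSet n} where
  open PolySolver n
  private
    P : Set
    P = Poly n

  Ideal-≋ : ∀ {p q : P} → p ≋ q → Ideal S p → Ideal S q
  Ideal-≋ e (mkIdeal cs a f) = mkIdeal cs a (≋-trans (≋-sym e) f)

  Ideal-0 : Ideal S 0ₚ
  Ideal-0 = mkIdeal [] [] ≋-refl

  Ideal-generator : ∀ {g : P} → S g → Ideal S g
  Ideal-generator {g} s = mkIdeal ((1ₚ , g) ∷ []) (s ∷ []) (≋-sym (≋-trans (+ₚ-identityʳ (1ₚ *ₚ g)) (*ₚ-identityˡ g)))

  Ideal-+ : ∀ {p q : P} → Ideal S p → Ideal S q → Ideal S (p +ₚ q)
  Ideal-+ (mkIdeal cs a e) (mkIdeal ds b f) = mkIdeal (cs L.++ ds) (AllP.++⁺ a b) (≋-trans (+ₚ-cong e f) (≋-sym (idealSum-++ cs ds)))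

  Ideal-* : ∀ (r : P) {p : P} → Ideal S p → Ideal S (r *ₚ p)
  Ideal-* r (mkIdeal cs a e) = mkIdeal (map (λ t → (r *ₚ proj₁ t , proj₂ t)) cs) (AllP.map⁺ a)
    (≋-trans (*ₚ-cong (≋-refl {p = r}) e) (≋-sym (idealSum-* cs)))
    where
    idealSum-* : ∀ cs → idealSum (map (λ t → (r *ₚ proj₁ t , proj₂ t)) cs) ≋ (r *ₚ idealSum cs)
    idealSum-* [] = *ₚ-comm 0ₚ r
    idealSum-* ((c , g) ∷ cs) = ≋-trans (+ₚ-cong (≋-refl {p = (r *ₚ c) *ₚ g}) (idealSum-* cs))
       (solve 4 (λ r c g s → (r :* c) :* g :+ r :* s := r :* (c :* g :+ s)) ≋-refl r c g (idealSum cs))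

  Ideal-neg : ∀ {p : P} → Ideal S p → Ideal S (-ₚ p)
  Ideal-neg {p} i = Ideal-≋ (solve 1 (λ p → (:- con 1ℚ) :* p := :- p) ≋-refl p) (Ideal-* (-ₚ 1ₚ) i)

  Ideal-- : ∀ {p q : P} → Ideal S p → Ideal S q → Ideal S (p -ₚ q)
  Ideal-- i j = Ideal-+ i (Ideal-neg j)

  Ideal-diff-sym : ∀ {a b : P} → Ideal S (a -ₚ b) → Ideal S (b -ₚ a)
  Ideal-diff-sym {a} {b} i = Ideal-≋ (solve 2 (λ a b → :- (a :- b) := b :- a) ≋-refl a b) (Ideal-neg i)

  Ideal-diff-trans : ∀ {a b c : P} → Ideal S (a -ₚ b) → Ideal S (b -ₚ c) → Ideal S (a -ₚ c)
  Ideal-diff-trans {a} {b} {c} i j = Ideal-≋ (solve 3 (λ a b c → (a :- b) :+ (b :- c) := a :- c) ≋-refl a b c) (Ideal-+ i j)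

  Ideal-closed : IdealClosed (Ideal S)
  Ideal-closed = record { closed-≋ = Ideal-≋ ; closed-0 = Ideal-0 ; closed-+ = Ideal-+ ; closed-* = Ideal-* }

  Cone-≋ : ∀ {p q : P} → p ≋ q → Cone S p → Cone S q
  Cone-≋ e (mkCone cs a f) = mkCone cs a (≋-trans (≋-sym e) f)

  Cone-0 : Cone S 0ₚ
  Cone-0 = mkCone [] [] ≋-refl

  Cone-generator : ∀ {g : P} → S g → Cone S g
  Cone-generator {g} s = mkCone ((1ℚ , g) ∷ []) ((ℚP.nonNegative⁻¹ 1ℚ , s) ∷ [])
    (≋-sym (≋-trans (+ₚ-identityʳ (const 1ℚ *ₚ g)) (*ₚ-identityˡ g)))

  Cone-+ : ∀ {p q : P} → Cone S p → Cone S q → Cone S (p +ₚ q)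
  Cone-+ (mkCone cs a e) (mkCone ds b f) = mkCone (cs L.++ ds) (AllP.++⁺ a b) (≋-trans (+ₚ-cong e f) (≋-sym (coneSum-++ cs ds)))

  Cone-scale : ∀ (c : ℚ) → 0ℚ ℚ.≤ c → {p : P} → Cone S p → Cone S (const c *ₚ p)
  Cone-scale c c≥0 (mkCone cs a e) = mkCone (map (λ t → (c *ℚ proj₁ t , proj₂ t)) cs) (AllP.map⁺ (All.map (λ (d≥0 , s) → nonNeg-* d≥0 , s) a))
    (≋-trans (*ₚ-cong (≋-refl {p = const c}) e) (≋-sym (coneSum-scale cs)))
    where
    nonNeg-* : ∀ {d} → 0ℚ ℚ.≤ d → 0ℚ ℚ.≤ c *ℚ d
    nonNeg-* {d} d≥0 = ℚP.≤-trans (ℚP.≤-reflexive (sym (ℚP.*-zeroʳ c))) (ℚP.*-monoˡ-≤-nonNeg c {{ℚ.nonNegative c≥0}} d≥0)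
    coneSum-scale : ∀ (cs : List (ℚ × P)) → coneSum (map (λ t → (c *ℚ proj₁ t , proj₂ t)) cs) ≋ (const c *ₚ coneSum cs)
    coneSum-scale [] = *ₚ-comm 0ₚ (const c)
    coneSum-scale ((d , g) ∷ cs) = ≋-trans (+ₚ-cong (*ₚ-cong (const-* c d) (≋-refl {p = g})) (coneSum-scale cs))
      (solve 4 (λ c d g s → (c :* d) :* g :+ c :* s := c :* (d :* g :+ s)) ≋-refl (const c) (const d) g (coneSum cs))

  Cone-closed : ConeClosed (Cone S)
  Cone-closed = record { closed-≋ = Cone-≋ ; closed-0 = Cone-0 ; closed-+ = Cone-+ ; closed-scale = Cone-scale }

Ideal-mono : ∀ {n} {S S′ : PSet n} → (∀ {g} → S g → Ideal S′ g) → ∀ {p} → Ideal S p → Ideal S′ p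
Ideal-mono = Ideal-ind Ideal-closed

natℚ : ℕ → ℚ
natℚ zero = 0ℚ
natℚ (suc n) = 1ℚ +ℚ natℚ n

intℚ : ℤ → ℚ
intℚ (+ n) = natℚ n
intℚ -[1+ n ] = -ℚ natℚ (suc n)

natℚ≃ : ∀ n → toℚᵘ (natℚ n) ℚᵘ.≃ mkℚᵘ (+ n) 0
natℚ≃ zero = *≡* refl
natℚ≃ (suc n) = ℚᵘP.≃-trans (ℚP.toℚᵘ-homo-+ 1ℚ (natℚ n)) (ℚᵘP.≃-trans (ℚᵘP.+-congʳ (toℚᵘ 1ℚ) (natℚ≃ n)) (*≡* eq))
  where
  open ℤ-Solver.+-*-Solver
  eq : (+ 1 ℤ.* + 1 ℤ.+ + n ℤ.* + 1) ℤ.* + 1 ≡ + suc n ℤ.* + 1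
  eq = trans (solve 1 (λ x → (con (+ 1) :* con (+ 1) :+ x :* con (+ 1)) :* con (+ 1) := (con (+ 1) :+ x) :* con (+ 1)) refl (+ n))
             (cong (ℤ._* + 1) (sym (ℤP.pos-+ 1 n)))

intℚ≃ : ∀ z → toℚᵘ (intℚ z) ℚᵘ.≃ mkℚᵘ z 0
intℚ≃ (+ n) = natℚ≃ n
intℚ≃ -[1+ n ] = ℚᵘP.≃-trans (ℚP.toℚᵘ-homo‿- (natℚ (suc n))) (ℚᵘP.-‿cong (natℚ≃ (suc n)))

denominator*≡numerator : ∀ c → natℚ (suc (ℚ.denominator-1 c)) *ℚ c ≡ intℚ (ℚ.numerator c)
denominator*≡numerator c@(mkℚ z d _) = ℚP.toℚᵘ-injective (ℚᵘP.≃-trans (ℚP.toℚᵘ-homo-* (natℚ (suc d)) c)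
   (ℚᵘP.≃-trans (ℚᵘP.*-congʳ (natℚ≃ (suc d))) (ℚᵘP.≃-trans (*≡* eq) (ℚᵘP.≃-sym (intℚ≃ z)))))
  where
  open ℤ-Solver.+-*-Solver
  eq : (+ suc d ℤ.* z) ℤ.* + 1 ≡ z ℤ.* (+ (1 ℕ.* suc d))
  eq = trans (solve 2 (λ D z → (D :* z) :* con (+ 1) := z :* D) refl (+ suc d) z) (cong (λ x → z ℤ.* + x) (sym (ℕP.+-identityʳ (suc d))))

natℚ-suc≢0 : ∀ n → natℚ (suc n) ≢ 0ℚ
natℚ-suc≢0 n e with ℚᵘP.≃-trans (ℚᵘP.≃-sym (natℚ≃ (suc n))) (ℚP.toℚᵘ-cong e)
... | *≡* ()

record IsPolyHom {a b : ℕ} (ψ : Poly a → Poly b) : Set where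
  field
    h-cong : ∀ {p q} → p ≋ q → ψ p ≋ ψ q
    h-+ : ∀ p q → ψ (p +ₚ q) ≋ (ψ p +ₚ ψ q)
    h-* : ∀ p q → ψ (p *ₚ q) ≋ (ψ p *ₚ ψ q)
    h-1 : ψ 1ₚ ≋ 1ₚ

isRingHom⇒isPolyHom : ∀ {a b} {f : Poly a → Poly b} → IsRingHom f → IsPolyHom f
isRingHom⇒isPolyHom {f = f} f-hom = record
  { h-cong = λ {p} {q} e → mk≋ (IsRingHom.cong-≈ f-hom p q (get e))
  ; h-+ = λ p q → mk≋ (IsRingHom.hom-+ f-hom p q)
  ; h-* = λ p q → mk≋ (IsRingHom.hom-* f-hom p q)
  ; h-1 = mk≋ (IsRingHom.hom-1 f-hom) }

_^ₚ_ : ∀ {n} → Poly n → ℕ → Poly n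
a ^ₚ zero = 1ₚ
a ^ₚ suc e = a *ₚ (a ^ₚ e)

evalMon : ∀ {j n} → (Fin j → Poly n) → Mon j → Poly n
evalMon g [] = 1ₚ
evalMon g (e ∷ v) = (g zero ^ₚ e) *ₚ evalMon (g ∘ suc) v

module IsPolyHom-properties {a b : ℕ} {ψ : Poly a → Poly b} (ψ-hom : IsPolyHom ψ) where
  open IsPolyHom ψ-hom
  open PolySolver b

  h-0 : ψ 0ₚ ≋ 0ₚ
  h-0 = ≋-trans (solve 1 (λ x → x := (x :+ x) :- x) ≋-refl (ψ 0ₚ))
          (≋-trans (+ₚ-cong (≋-sym (h-+ 0ₚ 0ₚ)) (≋-refl {p = -ₚ ψ 0ₚ})) (-ₚ-inverseʳ (ψ 0ₚ)))

  h-neg : ∀ p → ψ (-ₚ p) ≋ (-ₚ ψ p)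
  h-neg p = ≋-trans (solve 2 (λ x y → y := (x :+ y) :- x) ≋-refl (ψ p) (ψ (-ₚ p)))
     (≋-trans (+ₚ-cong (≋-trans (≋-sym (h-+ p (-ₚ p))) (≋-trans (h-cong (-ₚ-inverseʳ p)) h-0)) (≋-refl {p = -ₚ ψ p})) (+ₚ-identityˡ (-ₚ ψ p)))

  h-- : ∀ p q → ψ (p -ₚ q) ≋ (ψ p -ₚ ψ q)
  h-- p q = ≋-trans (h-+ p (-ₚ q)) (+ₚ-cong (≋-refl {p = ψ p}) (h-neg q))

  h-natℚ : ∀ n → ψ (const (natℚ n)) ≋ const (natℚ n)
  h-natℚ zero = ≋-trans (h-cong (const-0 {a})) (≋-trans h-0 (≋-sym (const-0 {b})))
  h-natℚ (suc n) = ≋-trans (h-cong (const-+ 1ℚ (natℚ n)))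
    (≋-trans (h-+ 1ₚ (const (natℚ n))) (≋-trans (+ₚ-cong h-1 (h-natℚ n)) (≋-sym (const-+ 1ℚ (natℚ n)))))

  h-intℚ : ∀ z → ψ (const (intℚ z)) ≋ const (intℚ z)
  h-intℚ (+ n) = h-natℚ n
  h-intℚ -[1+ n ] = ≋-trans (h-neg (const (natℚ (suc n)))) (-ₚ-cong (h-natℚ (suc n)))

  -- Multiplying by the denominator d reduces to integers; then cancel the unit const d.
  h-const : ∀ c → ψ (const c) ≋ const c
  h-const c = begin
    ψ (const c)                                ≈⟨ ≋-sym (*ₚ-identityˡ (ψ (const c))) ⟩
    1ₚ *ₚ ψ (const c)                          ≈⟨ *ₚ-cong (≋-sym d⁻¹d≋1) (≋-refl {p = ψ (const c)}) ⟩
    (const (ℚ.1/ d) *ₚ const d) *ₚ ψ (const c) ≈⟨ *ₚ-assoc (const (ℚ.1/ d)) (const d) (ψ (const c)) ⟩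
    const (ℚ.1/ d) *ₚ (const d *ₚ ψ (const c)) ≈⟨ *ₚ-cong (≋-refl {p = const (ℚ.1/ d)}) d·ψc≋d·c ⟩
    const (ℚ.1/ d) *ₚ (const d *ₚ const c)     ≈⟨ *ₚ-assoc (const (ℚ.1/ d)) (const d) (const c) ⟨
    (const (ℚ.1/ d) *ₚ const d) *ₚ const c     ≈⟨ *ₚ-cong d⁻¹d≋1 (≋-refl {p = const c}) ⟩
    1ₚ *ₚ const c                              ≈⟨ *ₚ-identityˡ (const c) ⟩
    const c                                    ∎
    where
    open import Relation.Binary.Reasoning.Setoid (CommutativeRing.setoid (PolyRing b))
    d : ℚ
    d = natℚ (suc (ℚ.denominator-1 c))
    instance
      d≢0 : ℚ.NonZero d
      d≢0 = ℚ.≢-nonZero (natℚ-suc≢0 (ℚ.denominator-1 c))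
    d⁻¹d≋1 : (const (ℚ.1/ d) *ₚ const d) ≋ 1ₚ
    d⁻¹d≋1 = ≋-trans (≋-sym (const-* (ℚ.1/ d) d)) (≋-reflexive (cong const (ℚP.*-inverseˡ d)))
    d·ψc≋d·c : (const d *ₚ ψ (const c)) ≋ (const d *ₚ const c)
    d·ψc≋d·c = begin
      const d *ₚ ψ (const c)            ≈⟨ *ₚ-cong (≋-sym (h-natℚ (suc (ℚ.denominator-1 c)))) (≋-refl {p = ψ (const c)}) ⟩
      ψ (const d) *ₚ ψ (const c)        ≈⟨ ≋-sym (h-* (const d) (const c)) ⟩
      ψ (const d *ₚ const c)            ≈⟨ h-cong (≋-trans (≋-sym (const-* d c)) (≋-reflexive (cong const (denominator*≡numerator c)))) ⟩
      ψ (const (intℚ (ℚ.numerator c)))  ≈⟨ h-intℚ (ℚ.numerator c) ⟩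
      const (intℚ (ℚ.numerator c))      ≈⟨ ≋-trans (≋-reflexive (cong const (sym (denominator*≡numerator c)))) (const-* d c) ⟩
      const d *ₚ const c                ∎

  h-^ₚ : ∀ x e → ψ (x ^ₚ e) ≋ (ψ x ^ₚ e)
  h-^ₚ x zero = h-1
  h-^ₚ x (suc e) = ≋-trans (h-* x (x ^ₚ e)) (*ₚ-cong (≋-refl {p = ψ x}) (h-^ₚ x e))

  h-evalMon : ∀ {j} (g : Fin j → Poly a) v → ψ (evalMon g v) ≋ evalMon (ψ ∘ g) v
  h-evalMon g [] = h-1
  h-evalMon g (e ∷ v) = ≋-trans (h-* (g zero ^ₚ e) (evalMon (g ∘ suc) v)) (*ₚ-cong (h-^ₚ (g zero) e) (h-evalMon (g ∘ suc) v))

  pullback-idealClosed : ∀ {Q : Poly b → Set} → IdealClosed Q → IdealClosed (Q ∘ ψ)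
  pullback-idealClosed closed = record
    { closed-≋ = λ e → closed-≋ (h-cong e)
    ; closed-0 = closed-≋ (≋-sym h-0) closed-0
    ; closed-+ = λ {p} {q} x y → closed-≋ (≋-sym (h-+ p q)) (closed-+ x y)
    ; closed-* = λ r {p} x → closed-≋ (≋-sym (h-* r p)) (closed-* (ψ r) x) }
    where open IdealClosed closed

  pullback-coneClosed : ∀ {Q : Poly b → Set} → ConeClosed Q → ConeClosed (Q ∘ ψ)
  pullback-coneClosed closed = record
    { closed-≋ = λ e → closed-≋ (h-cong e)
    ; closed-0 = closed-≋ (≋-sym h-0) closed-0
    ; closed-+ = λ {p} {q} x y → closed-≋ (≋-sym (h-+ p q)) (closed-+ x y)
    ; closed-scale = λ c c≥0 {p} x → closed-≋ (≋-sym (≋-trans (h-* (const c) p) (*ₚ-cong (h-const c) (≋-refl {p = ψ p})))) (closed-scale c c≥0 x) }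
    where open ConeClosed closed

  Ideal-map : ∀ {S : PSet a} {S′ : PSet b} → (∀ {g} → S g → Ideal S′ (ψ g)) → ∀ {p} → Ideal S p → Ideal S′ (ψ p)
  Ideal-map = Ideal-ind (pullback-idealClosed Ideal-closed)

monomial : ∀ {n} → Mon n → Poly n
monomial v = (1ℚ , v) ∷ []

monomial-* : ∀ {n} (u v : Mon n) → (monomial u *ₚ monomial v) ≋ monomial (u *ᵐ v)
monomial-* u v = ≋-byPairing λ F → cong (λ x → x *ℚ F (u *ᵐ v) +ℚ 0ℚ) (ℚP.*-identityˡ 1ℚ)

mapMon : ∀ {a b} → (Mon a → Mon b) → Poly a → Poly b
mapMon φ = map (λ t → (proj₁ t , φ (proj₂ t)))

record IsMonHom {a b} (φ : Mon a → Mon b) : Set where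
  field
    m-* : ∀ u v → φ (u *ᵐ v) ≡ φ u *ᵐ φ v
    m-1 : φ 1ᵐ ≡ 1ᵐ

mapMon-isPolyHom : ∀ {a b} {φ : Mon a → Mon b} → IsMonHom φ → IsPolyHom (mapMon φ)
mapMon-isPolyHom {φ = φ} φ-hom = record
  { h-cong = λ {p} {q} e → ≋-byPairing λ F → trans (pair-mapMon F φ p) (trans (pair-cong (F ∘ φ) e) (sym (pair-mapMon F φ q)))
  ; h-+ = λ p q → ≋-reflexive (LP.map-++ _ p q)
  ; h-* = λ p q → ≋-byPairing λ F → trans (pair-mapMon F φ (p *ₚ q)) (trans (pair-*ₚ _ p q)
       (sym (trans (pair-*ₚ F (mapMon φ p) (mapMon φ q)) (trans (pair-mapMon _ φ p)
          (pair-ext p (λ v → trans (pair-mapMon _ φ q) (pair-ext q (λ w → cong F (sym (m-* v w))))))))))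
  ; h-1 = ≋-reflexive (cong (λ u → (1ℚ , u) ∷ []) m-1) }
  where open IsMonHom φ-hom

linExt : ∀ {a b} → (Mon a → Poly b) → Poly a → Poly b
linExt H p = sumₚ (map (λ t → const (proj₁ t) *ₚ H (proj₂ t)) p)

pair-const-*ₚ : ∀ {n} F c (p : Poly n) → pair F (const c *ₚ p) ≡ c *ℚ pair F p
pair-const-*ₚ F c p = trans (pair-*ₚ F (const c) p) (trans (ℚP.+-identityʳ _) (cong (c *ℚ_) (pair-ext p (λ w → cong F (*ᵐ-identityˡ w)))))

pair-linExt : ∀ {a b} F (H : Mon a → Poly b) p → pair F (linExt H p) ≡ pair (λ v → pair F (H v)) p
pair-linExt F H [] = refl
pair-linExt F H ((c , v) ∷ p) = trans (pair-++ F (const c *ₚ H v) (linExt H p)) (cong₂ _+ℚ_ (pair-const-*ₚ F c (H v)) (pair-linExt F H p))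

linExt-monomial : ∀ {n} (p : Poly n) → linExt monomial p ≋ p
linExt-monomial p = ≋-byPairing λ F → trans (pair-linExt F monomial p) (pair-ext p (λ v → trans (ℚP.+-identityʳ _) (ℚP.*-identityˡ _)))

linExt-mapMon : ∀ {a b c} (H : Mon b → Poly c) (φ : Mon a → Mon b) p → linExt H (mapMon φ p) ≡ linExt (H ∘ φ) p
linExt-mapMon H φ p = cong sumₚ (sym (LP.map-∘ p))

module _ {a b : ℕ} where
  linExt-ext : ∀ {H H′ : Mon a → Poly b} → (∀ u → H u ≋ H′ u) → ∀ p → linExt H p ≋ linExt H′ p
  linExt-ext {H} {H′} h p = ≋-byPairing λ F → trans (pair-linExt F H p) (trans (pair-ext p (λ v → pair-cong F (h v))) (sym (pair-linExt F H′ p)))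

  linExt-- : ∀ (H H′ : Mon a → Poly b) p → linExt (λ u → H u -ₚ H′ u) p ≋ (linExt H p -ₚ linExt H′ p)
  linExt-- H H′ p = ≋-byPairing λ F → begin
    pair F (linExt (λ u → H u -ₚ H′ u) p)                  ≡⟨ pair-linExt F _ p ⟩
    pair (λ v → pair F (H v -ₚ H′ v)) p                    ≡⟨ pair-ext p (λ v → pair-- F (H v) (H′ v)) ⟩
    pair (λ v → pair F (H v) +ℚ -ℚ pair F (H′ v)) p        ≡⟨ pair-+ˡ _ _ p ⟩
    pair (λ v → pair F (H v)) p +ℚ pair (λ v → -ℚ pair F (H′ v)) p
                                                           ≡⟨ cong₂ _+ℚ_ (sym (pair-linExt F H p)) (trans (pair-negˡ _ p) (cong -ℚ_ (sym (pair-linExt F H′ p)))) ⟩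
    pair F (linExt H p) +ℚ -ℚ pair F (linExt H′ p)         ≡⟨ sym (pair-- F (linExt H p) (linExt H′ p)) ⟩
    pair F (linExt H p -ₚ linExt H′ p)                     ∎
    where open ≡-Reasoning

  linExt-isPolyHom : ∀ (H : Mon a → Poly b) → (∀ u v → H (u *ᵐ v) ≋ (H u *ₚ H v)) → H 1ᵐ ≋ 1ₚ → IsPolyHom (linExt H)
  linExt-isPolyHom H H-* H-1 = record
    { h-cong = λ {p} {q} e → ≋-byPairing λ F → trans (pair-linExt F H p) (trans (pair-cong _ e) (sym (pair-linExt F H q)))
    ; h-+ = λ p q → ≋-trans (≋-reflexive (cong sumₚ (LP.map-++ _ p q))) (sumₚ-++ (map _ p) _)
    ; h-* = λ p q → ≋-byPairing λ F → trans (pair-linExt F H (p *ₚ q)) (trans (pair-*ₚ _ p q)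
        (sym (trans (pair-*ₚ F (linExt H p) (linExt H q)) (trans (pair-linExt _ H p) (pair-ext p (λ u →
          trans (pair-ext (H u) (λ v → pair-linExt (λ w → F (v *ᵐ w)) H q))
          (trans (pair-swap (λ v u′ → pair (λ w → F (v *ᵐ w)) (H u′)) (H u) q)
          (pair-ext q (λ u′ → trans (sym (pair-*ₚ F (H u) (H u′))) (sym (pair-cong F (H-* u u′))))))))))))
    ; h-1 = ≋-trans (+ₚ-identityʳ (const 1ℚ *ₚ H 1ᵐ)) (≋-trans (*ₚ-identityˡ (H 1ᵐ)) H-1) }

  linExt-Ideal : ∀ {S : PSet b} (H : Mon a → Poly b) → (∀ u → Ideal S (H u)) → ∀ p → Ideal S (linExt H p)
  linExt-Ideal H h [] = Ideal-0
  linExt-Ideal H h ((c , v) ∷ p) = Ideal-+ (Ideal-* (const c) (h v)) (linExt-Ideal H h p)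

h-linExt : ∀ {a b c} {ψ : Poly b → Poly c} → IsPolyHom ψ → ∀ (H : Mon a → Poly b) p → ψ (linExt H p) ≋ linExt (ψ ∘ H) p
h-linExt ψ-hom H [] = IsPolyHom-properties.h-0 ψ-hom
h-linExt {ψ = ψ} ψ-hom H ((c , v) ∷ p) =
  ≋-trans (h-+ (const c *ₚ H v) (linExt H p)) (+ₚ-cong (≋-trans (h-* (const c) (H v)) (*ₚ-cong (h-const c) (≋-refl {p = ψ (H v)}))) (h-linExt ψ-hom H p))
  where
  open IsPolyHom ψ-hom
  open IsPolyHom-properties ψ-hom

module _ {n : ℕ} where
  open PolySolver n

  ^ₚ-+ : ∀ (a : Poly n) e e′ → (a ^ₚ (e + e′)) ≋ ((a ^ₚ e) *ₚ (a ^ₚ e′))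
  ^ₚ-+ a zero e′ = ≋-sym (*ₚ-identityˡ (a ^ₚ e′))
  ^ₚ-+ a (suc e) e′ = ≋-trans (*ₚ-cong (≋-refl {p = a}) (^ₚ-+ a e e′)) (≋-sym (*ₚ-assoc a (a ^ₚ e) (a ^ₚ e′)))

  evalMon-* : ∀ {j} (g : Fin j → Poly n) (u v : Mon j) → evalMon g (u *ᵐ v) ≋ (evalMon g u *ₚ evalMon g v)
  evalMon-* g [] [] = ≋-sym (*ₚ-identityˡ 1ₚ)
  evalMon-* g (e ∷ u) (e′ ∷ v) = ≋-trans (*ₚ-cong (^ₚ-+ (g zero) e e′) (evalMon-* (g ∘ suc) u v))
    (solve 4 (λ a b c d → (a :* b) :* (c :* d) := (a :* c) :* (b :* d)) ≋-refl (g zero ^ₚ e) (g zero ^ₚ e′) (evalMon (g ∘ suc) u) (evalMon (g ∘ suc) v))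

  evalMon-1 : ∀ {j} (g : Fin j → Poly n) → evalMon g 1ᵐ ≋ 1ₚ
  evalMon-1 {zero} g = ≋-refl
  evalMon-1 {suc j} g = ≋-trans (*ₚ-identityˡ (evalMon (g ∘ suc) 1ᵐ)) (evalMon-1 (g ∘ suc))

var-zero-^ₚ : ∀ {n} e → (var {suc n} zero ^ₚ e) ≋ monomial (e ∷ replicate n 0)
var-zero-^ₚ {n} zero = ≋-refl
var-zero-^ₚ {n} (suc e) = ≋-trans (*ₚ-cong (≋-refl {p = var zero}) (var-zero-^ₚ e))
  (≋-trans (monomial-* (1 ∷ replicate n 0) (e ∷ replicate n 0)) (≋-reflexive (cong (λ w → monomial (suc e ∷ w)) (*ᵐ-identityˡ (replicate n 0)))))

monomial≋evalMon-var : ∀ {n} (v : Mon n) → monomial v ≋ evalMon var v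
monomial≋evalMon-var [] = ≋-refl
monomial≋evalMon-var {suc n} (e ∷ w) = ≋-sym (begin
  (var zero ^ₚ e) *ₚ evalMon (var ∘ suc) w        ≈⟨ *ₚ-cong (var-zero-^ₚ e) tail≋ ⟩
  monomial (e ∷ replicate n 0) *ₚ monomial (0 ∷ w) ≈⟨ monomial-* (e ∷ replicate n 0) (0 ∷ w) ⟩
  monomial ((e + 0) ∷ (replicate n 0 *ᵐ w))       ≡⟨ cong₂ (λ a b → monomial (a ∷ b)) (ℕP.+-identityʳ e) (*ᵐ-identityˡ w) ⟩
  monomial (e ∷ w)                                ∎)
  where
  open import Relation.Binary.Reasoning.Setoid (CommutativeRing.setoid (PolyRing (suc n)))
  shift-hom : IsPolyHom (mapMon (0 ∷_))
  shift-hom = mapMon-isPolyHom {n} record { m-* = λ u v → refl ; m-1 = refl }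
  tail≋ : evalMon (var ∘ suc) w ≋ monomial (0 ∷ w)
  tail≋ = ≋-trans (≋-sym (IsPolyHom-properties.h-evalMon shift-hom var w)) (IsPolyHom.h-cong shift-hom (≋-sym (monomial≋evalMon-var w)))

module _ {n : ℕ} {S : PSet n} where
  open PolySolver n

  Ideal-*-diff : ∀ {a a′ b b′ : Poly n} → Ideal S (a -ₚ a′) → Ideal S (b -ₚ b′) → Ideal S ((a *ₚ b) -ₚ (a′ *ₚ b′))
  Ideal-*-diff {a} {a′} {b} {b′} da db =
    Ideal-≋ (solve 4 (λ a a′ b b′ → a :* (b :- b′) :+ b′ :* (a :- a′) := a :* b :- a′ :* b′) ≋-refl a a′ b b′)
      (Ideal-+ (Ideal-* a db) (Ideal-* b′ da))

  Ideal-^ₚ-diff : ∀ {a a′ : Poly n} → Ideal S (a -ₚ a′) → ∀ e → Ideal S ((a ^ₚ e) -ₚ (a′ ^ₚ e))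
  Ideal-^ₚ-diff da zero = Ideal-≋ (≋-sym (-ₚ-inverseʳ 1ₚ)) Ideal-0
  Ideal-^ₚ-diff {a} {a′} da (suc e) = Ideal-*-diff {a} {a′} {a ^ₚ e} {a′ ^ₚ e} da (Ideal-^ₚ-diff da e)

  Ideal-evalMon-diff : ∀ {j} (g g′ : Fin j → Poly n) → (∀ i → Ideal S (g i -ₚ g′ i)) → ∀ v → Ideal S (evalMon g v -ₚ evalMon g′ v)
  Ideal-evalMon-diff g g′ dg [] = Ideal-≋ (≋-sym (-ₚ-inverseʳ 1ₚ)) Ideal-0
  Ideal-evalMon-diff g g′ dg (e ∷ v) =
    Ideal-*-diff {g zero ^ₚ e} {g′ zero ^ₚ e} {evalMon (g ∘ suc) v} {evalMon (g′ ∘ suc) v}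
      (Ideal-^ₚ-diff (dg zero) e) (Ideal-evalMon-diff (g ∘ suc) (g′ ∘ suc) (dg ∘ suc) v)

replicate-++ : ∀ m k → replicate m 0 ++ replicate k 0 ≡ replicate (m + k) 0
replicate-++ zero k = refl
replicate-++ (suc m) k = cong (0 ∷_) (replicate-++ m k)

take-++ : ∀ {A : Set} m {k} (u : Vec A m) (v : Vec A k) → take m (u ++ v) ≡ u
take-++ zero [] v = refl
take-++ (suc m) (x ∷ u) v = cong (x ∷_) (take-++ m u v)

drop-++ : ∀ {A : Set} m {k} (u : Vec A m) (v : Vec A k) → drop m (u ++ v) ≡ v
drop-++ zero [] v = refl
drop-++ (suc m) (x ∷ u) v = drop-++ m u v

module XY (m k : ℕ) where

  embXᵐ-isMonHom : IsMonHom (embXᵐ {m} k)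
  embXᵐ-isMonHom = record
    { m-* = λ u v → sym (trans (VP.zipWith-++ _+_ u (replicate k 0) v (replicate k 0)) (cong ((u *ᵐ v) ++_) (*ᵐ-identityˡ (replicate k 0))))
    ; m-1 = replicate-++ m k }

  embYᵐ-isMonHom : IsMonHom (embYᵐ m {k})
  embYᵐ-isMonHom = record
    { m-* = λ u v → sym (trans (VP.zipWith-++ _+_ (replicate m 0) u (replicate m 0) v) (cong (_++ (u *ᵐ v)) (*ᵐ-identityˡ (replicate m 0))))
    ; m-1 = replicate-++ m k }

  take-1 : take {A = ℕ} m {k} 1ᵐ ≡ 1ᵐ
  take-1 = trans (cong (take m) (sym (replicate-++ m k))) (take-++ m (replicate m 0) (replicate k 0))

  drop-isMonHom : IsMonHom (drop {A = ℕ} m {k})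
  drop-isMonHom = record
    { m-* = VP.drop-zipWith _+_
    ; m-1 = trans (cong (drop m) (sym (replicate-++ m k))) (drop-++ m (replicate m 0) (replicate k 0)) }

  embX-isPolyHom : IsPolyHom (embX {m} k)
  embX-isPolyHom = mapMon-isPolyHom embXᵐ-isMonHom

  embY-isPolyHom : IsPolyHom (embY m {k})
  embY-isPolyHom = mapMon-isPolyHom embYᵐ-isMonHom

  toY-isPolyHom : IsPolyHom (toY m {k})
  toY-isPolyHom = mapMon-isPolyHom drop-isMonHom

  embY-toY : ∀ g → InQY m {k} g → embY m {k} (toY m {k} g) ≋ g
  embY-toY g g∈ℚ[Y] = ≋-byPairing λ F → trans (pair-mapMon F (embYᵐ m) (toY m g)) (trans (pair-mapMon _ (drop m) g)
     (pair-supp _ F g (λ u s → cong F (trans (cong (_++ drop m u) (sym (g∈ℚ[Y] u s))) (VP.take++drop≡id m u)))))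

  toY-embY : ∀ q → toY m (embY m {k} q) ≋ q
  toY-embY q = ≋-byPairing λ F → trans (pair-mapMon F (drop m) (embY m q)) (trans (pair-mapMon _ (embYᵐ m) q)
    (pair-ext q (λ v → cong F (drop-++ m (replicate m 0) v))))

  embXᵐ*embYᵐ : ∀ (u : Mon (m + k)) → embXᵐ k (take m u) *ᵐ embYᵐ m (drop m u) ≡ u
  embXᵐ*embYᵐ u = trans (VP.zipWith-++ _+_ (take m u) (replicate k 0) (replicate m 0) (drop m u))
    (trans (cong₂ _++_ (*ᵐ-identityʳ (take m u)) (*ᵐ-identityˡ (drop m u))) (VP.take++drop≡id m u))

module Substitution (m k : ℕ) (f : Poly k → Poly m) (f-hom : IsPolyHom f) where
  open XY m k
  open PolySolver m

  σᵐ : Mon (m + k) → Poly m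
  σᵐ u = evalMon var (take m u) *ₚ evalMon (f ∘ var) (drop m u)

  σ : Poly (m + k) → Poly m
  σ = linExt σᵐ

  σ-isPolyHom : IsPolyHom σ
  σ-isPolyHom = linExt-isPolyHom σᵐ σᵐ-* σᵐ-1
    where
    σᵐ-* : ∀ u v → σᵐ (u *ᵐ v) ≋ (σᵐ u *ₚ σᵐ v)
    σᵐ-* u v = ≋-trans (≋-reflexive (cong₂ (λ a b → evalMon var a *ₚ evalMon (f ∘ var) b) (VP.take-zipWith _+_ u v) (IsMonHom.m-* drop-isMonHom u v)))
       (≋-trans (*ₚ-cong (evalMon-* var (take m u) (take m v)) (evalMon-* (f ∘ var) (drop m u) (drop m v)))
       (solve 4 (λ a b c d → (a :* b) :* (c :* d) := (a :* c) :* (b :* d)) ≋-refl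
          (evalMon var (take m u)) (evalMon var (take m v)) (evalMon (f ∘ var) (drop m u)) (evalMon (f ∘ var) (drop m v))))
    σᵐ-1 : σᵐ 1ᵐ ≋ 1ₚ
    σᵐ-1 = ≋-trans (≋-reflexive (cong₂ (λ a b → evalMon var a *ₚ evalMon (f ∘ var) b) take-1 (IsMonHom.m-1 drop-isMonHom)))
       (≋-trans (*ₚ-cong (evalMon-1 var) (evalMon-1 (f ∘ var))) (*ₚ-identityˡ 1ₚ))

  σ-embX : ∀ p → σ (embX k p) ≋ p
  σ-embX p = ≋-trans (≋-reflexive (linExt-mapMon σᵐ (embXᵐ k) p)) (≋-trans (linExt-ext on-monomials p) (linExt-monomial p))
    where
    on-monomials : ∀ u → σᵐ (embXᵐ k u) ≋ monomial u
    on-monomials u = ≋-trans (≋-reflexive (cong₂ (λ a b → evalMon var a *ₚ evalMon (f ∘ var) b) (take-++ m u (replicate k 0)) (drop-++ m u (replicate k 0))))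
      (≋-trans (*ₚ-cong (≋-sym (monomial≋evalMon-var u)) (evalMon-1 (f ∘ var))) (*ₚ-identityʳ (monomial u)))

  σ-embY : ∀ q → σ (embY m q) ≋ f q
  σ-embY q = ≋-trans (≋-reflexive (linExt-mapMon σᵐ (embYᵐ m) q)) (≋-trans (linExt-ext on-monomials q)
     (≋-trans (≋-sym (h-linExt f-hom monomial q)) (IsPolyHom.h-cong f-hom (linExt-monomial q))))
    where
    on-monomials : ∀ v → σᵐ (embYᵐ m v) ≋ f (monomial v)
    on-monomials v = ≋-trans (≋-reflexive (cong₂ (λ a b → evalMon var a *ₚ evalMon (f ∘ var) b) (take-++ m (replicate m 0) v) (drop-++ m (replicate m 0) v)))
      (≋-trans (*ₚ-cong (evalMon-1 var) ≋-refl) (≋-trans (*ₚ-identityˡ _)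
        (≋-trans (≋-sym (IsPolyHom-properties.h-evalMon f-hom var v)) (IsPolyHom.h-cong f-hom (≋-sym (monomial≋evalMon-var v))))))

  private
    I : List (Poly m) → PSet (m + k)
    I Z = listSet (invHomGens m k f Z)

    graphGen : Fin k → Poly (m + k)
    graphGen y = embY m (var y) -ₚ embX k (f (var y))

  graphGen∈I : ∀ Z y → I Z (graphGen y)
  graphGen∈I Z y = ∈-++⁺ˡ (∈-map⁺ graphGen (∈-allFin y))

  embX∈I : ∀ Z {z} → z ∈ Z → I Z (embX k z)
  embX∈I Z z∈Z = ∈-++⁺ʳ (map graphGen (allFin k)) (∈-map⁺ (embX k) z∈Z)

  σ-Ideal : ∀ Z {p} → Ideal (I Z) p → Ideal (listSet Z) (σ p)
  σ-Ideal Z = IsPolyHom-properties.Ideal-map σ-isPolyHom generator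
    where
    generator : ∀ {g} → I Z g → Ideal (listSet Z) (σ g)
    generator g∈I with ∈-++⁻ (map graphGen (allFin k)) g∈I
    ... | inj₁ g∈graph with ∈-map⁻ graphGen g∈graph
    ...   | y , _ , refl = Ideal-≋ (≋-sym (begin
      σ (graphGen y)                               ≈⟨ IsPolyHom-properties.h-- σ-isPolyHom (embY m (var y)) (embX k (f (var y))) ⟩
      σ (embY m (var y)) -ₚ σ (embX k (f (var y))) ≈⟨ +ₚ-cong (σ-embY (var y)) (-ₚ-cong (σ-embX (f (var y)))) ⟩
      f (var y) -ₚ f (var y)                       ≈⟨ -ₚ-inverseʳ (f (var y)) ⟩
      0ₚ                                           ∎)) Ideal-0
      where open import Relation.Binary.Reasoning.Setoid (CommutativeRing.setoid (PolyRing m))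
    generator g∈I | inj₂ g∈Z with ∈-map⁻ (embX k) g∈Z
    ...   | z , z∈Z , refl = Ideal-≋ (≋-sym (σ-embX z)) (Ideal-generator z∈Z)

  embX-Ideal : ∀ Z {p} → Ideal (listSet Z) p → Ideal (I Z) (embX k p)
  embX-Ideal Z = IsPolyHom-properties.Ideal-map embX-isPolyHom (Ideal-generator ∘ embX∈I Z)

  -- Modulo the graph ideal every monomial x^a y^b equals x^a f(y)^b, which is embX (σᵐ (x^a y^b)).
  embX∘σ-Ideal : ∀ Z p → Ideal (I Z) (p -ₚ embX k (σ p))
  embX∘σ-Ideal Z p = Ideal-≋ (≋-sym linearised) (linExt-Ideal _ on-monomials p)
    where
    open PolySolver (m + k) using () renaming (solve to solve′; _:*_ to _:*′_; _:-_ to _:-′_; _:=_ to _:=′_)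
    open IsPolyHom-properties embX-isPolyHom using () renaming (h-evalMon to embX-evalMon)
    open IsPolyHom-properties embY-isPolyHom using () renaming (h-evalMon to embY-evalMon)
    linearised : (p -ₚ embX k (σ p)) ≋ linExt (λ u → monomial u -ₚ embX k (σᵐ u)) p
    linearised = ≋-trans (+ₚ-cong (≋-sym (linExt-monomial p)) (-ₚ-cong (h-linExt embX-isPolyHom σᵐ p)))
                         (≋-sym (linExt-- monomial (embX k ∘ σᵐ) p))
    on-monomials : ∀ u → Ideal (I Z) (monomial u -ₚ embX k (σᵐ u))
    on-monomials u = Ideal-≋ (≋-sym factored) (Ideal-* (embX k (monomial a)) y^b≡f[y]^b)
      where
      a : Mon m
      a = take m u
      b : Mon k
      b = drop m u
      y^b≡f[y]^b : Ideal (I Z) (embY m (monomial b) -ₚ embX k (evalMon (f ∘ var) b))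
      y^b≡f[y]^b = Ideal-≋ (≋-sym (+ₚ-cong (≋-trans (IsPolyHom.h-cong embY-isPolyHom (monomial≋evalMon-var b)) (embY-evalMon var b))
                                          (-ₚ-cong (embX-evalMon (f ∘ var) b))))
        (Ideal-evalMon-diff (embY m ∘ var) (embX k ∘ f ∘ var) (Ideal-generator ∘ graphGen∈I Z) b)
      factored : (monomial u -ₚ embX k (σᵐ u)) ≋ (embX k (monomial a) *ₚ (embY m (monomial b) -ₚ embX k (evalMon (f ∘ var) b)))
      factored = ≋-trans
        (+ₚ-cong (≋-trans (≋-reflexive (cong monomial (sym (embXᵐ*embYᵐ u)))) (≋-sym (monomial-* (embXᵐ k a) (embYᵐ m b))))
                 (-ₚ-cong (≋-trans (IsPolyHom.h-* embX-isPolyHom (evalMon var a) (evalMon (f ∘ var) b))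
                                   (*ₚ-cong (IsPolyHom.h-cong embX-isPolyHom (≋-sym (monomial≋evalMon-var a))) (≋-refl {p = embX k (evalMon (f ∘ var) b)})))))
        (solve′ 3 (λ x y z → (x :*′ y) :-′ (x :*′ z) :=′ x :*′ (y :-′ z)) ≋-refl
          (embX k (monomial a)) (embY m (monomial b)) (embX k (evalMon (f ∘ var) b)))

Rel₀ : Set → Set₁
Rel₀ A = A → A → Set

_↑_ : ∀ {A} → Rel₀ A → A → Rel₀ A
(R ↑ x) y z = R y z ⊎ R x y

-- Almost-full relations (Vytiniotis, Coquand, Wahlstedt): every sequence x₀ x₁ … has
-- i < j with R xᵢ xⱼ, witnessed by a well-founded tree.
data AF {A : Set} (R : Rel₀ A) : Set₁ where
  now : (∀ x y → R x y) → AF R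
  later : (∀ x → AF (R ↑ x)) → AF R

af-mono : ∀ {A} {R S : Rel₀ A} → (∀ x y → R x y → S x y) → AF R → AF S
af-mono i (now h) = now (λ x y → i x y (h x y))
af-mono i (later h) = later (λ x → af-mono (λ y z → λ { (inj₁ r) → inj₁ (i y z r) ; (inj₂ r) → inj₂ (i x y r) }) (h x))

af-comap : ∀ {A B} {R : Rel₀ A} (h : B → A) → AF R → AF (λ x y → R (h x) (h y))
af-comap h (now r) = now (λ x y → r (h x) (h y))
af-comap h (later r) = later (λ x → af-comap h (r (h x)))

af-ℕ-aux : ∀ N x → x ≤ N → AF (λ y z → y ≤ z ⊎ x ≤ y)
af-ℕ-aux N zero _ = now (λ y z → inj₂ z≤n)
af-ℕ-aux (suc N) (suc x) (s≤s x≤N) = later λ y → step y (suc x ℕ.≤? y)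
  where
  step : ∀ y → _ → AF (λ a b → (a ≤ b ⊎ suc x ≤ a) ⊎ (y ≤ a ⊎ suc x ≤ y))
  step y (yes sx≤y) = now (λ a b → inj₂ (inj₂ sx≤y))
  step y (no sx≰y) = af-mono (λ a b → λ { (inj₁ r) → inj₁ (inj₁ r) ; (inj₂ r) → inj₂ (inj₁ r) })
    (af-ℕ-aux N y (ℕP.≤-trans (ℕP.≤-pred (ℕP.≰⇒> sx≰y)) x≤N))

af-ℕ : AF _≤_
af-ℕ = later λ x → af-ℕ-aux x x ℕP.≤-refl

module _ {A B : Set} where
  af-sum-inj₁-full : ∀ {R2 : Rel₀ B} → AF R2 → (ρ : Rel₀ (A ⊎ B)) →
    (∀ a z → ρ (inj₁ a) z) → (∀ c d → R2 c d → ρ (inj₂ c) (inj₂ d)) → AF ρ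
  af-sum-inj₁-full (now h2) ρ al i2 = later λ
    { (inj₁ a) → now (λ y z → inj₂ (al a y))
    ; (inj₂ c) → now (λ { (inj₁ a') z → inj₁ (al a' z) ; (inj₂ d) z → inj₂ (i2 c d (h2 c d)) }) }
  af-sum-inj₁-full (later h2) ρ al i2 = later λ
    { (inj₁ a) → now (λ y z → inj₂ (al a y))
    ; (inj₂ c) → af-sum-inj₁-full (h2 c) _ (λ a z → inj₁ (al a z)) (λ d e → λ { (inj₁ r) → inj₁ (i2 d e r) ; (inj₂ r) → inj₂ (i2 c d r) }) }

  af-sum-inj₂-full : ∀ {R1 : Rel₀ A} → AF R1 → (ρ : Rel₀ (A ⊎ B)) →
    (∀ c z → ρ (inj₂ c) z) → (∀ a b → R1 a b → ρ (inj₁ a) (inj₁ b)) → AF ρ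
  af-sum-inj₂-full (now h1) ρ al i1 = later λ
    { (inj₂ c) → now (λ y z → inj₂ (al c y))
    ; (inj₁ a) → now (λ { (inj₂ c) z → inj₁ (al c z) ; (inj₁ b) z → inj₂ (i1 a b (h1 a b)) }) }
  af-sum-inj₂-full (later h1) ρ al i1 = later λ
    { (inj₂ c) → now (λ y z → inj₂ (al c y))
    ; (inj₁ a) → af-sum-inj₂-full (h1 a) _ (λ c z → inj₁ (al c z)) (λ d e → λ { (inj₁ r) → inj₁ (i1 d e r) ; (inj₂ r) → inj₂ (i1 a d r) }) }

  af-sum : ∀ {R1 : Rel₀ A} {R2 : Rel₀ B} → AF R1 → AF R2 → (ρ : Rel₀ (A ⊎ B)) →
    (∀ a b → R1 a b → ρ (inj₁ a) (inj₁ b)) → (∀ c d → R2 c d → ρ (inj₂ c) (inj₂ d)) → AF ρ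
  af-sum p1 p2 ρ i1 i2 = later λ { (inj₁ a) → left p1 a ; (inj₂ c) → right p2 c }
    where
    left : AF _ → ∀ a → AF (ρ ↑ inj₁ a)
    left (now h1) a = af-sum-inj₁-full p2 _ (λ b z → inj₂ (i1 a b (h1 a b))) (λ c d r → inj₁ (i2 c d r))
    left (later h1) a = af-sum (h1 a) p2 _ (λ b b' → λ { (inj₁ r) → inj₁ (i1 b b' r) ; (inj₂ r) → inj₂ (i1 a b r) }) (λ c d r → inj₁ (i2 c d r))
    right : AF _ → ∀ c → AF (ρ ↑ inj₂ c)
    right (now h2) c = af-sum-inj₂-full p1 _ (λ d z → inj₂ (i2 c d (h2 c d))) (λ a b r → inj₁ (i1 a b r))
    right (later h2) c = af-sum p1 (h2 c) _ (λ a b r → inj₁ (i1 a b r)) (λ d e → λ { (inj₁ r) → inj₁ (i2 d e r) ; (inj₂ r) → inj₂ (i2 c d r) })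

module _ {A : Set} where
  Levelled : Rel₀ A → ℕ → Rel₀ (ℕ × A)
  Levelled R N (n , a) (n' , a') = (n ≡ n' × R a a') ⊎ N ≤ n

  af-levels : ∀ {R : Rel₀ A} → AF R → ∀ N → AF (Levelled R N)
  af-levels p zero = now (λ x y → inj₂ z≤n)
  af-levels {R} p (suc N) = af-mono incl (af-comap h (af-sum (af-levels p N) p ρ (λ a b r → r) (λ c d r → r)))
    where
    ρ : Rel₀ ((ℕ × A) ⊎ A)
    ρ (inj₁ y) (inj₁ z) = Levelled R N y z
    ρ (inj₂ a) (inj₂ b) = R a b
    ρ _ _ = ⊥
    h : ℕ × A → (ℕ × A) ⊎ A
    h (n , a) with n ℕ.≟ N
    ... | yes _ = inj₂ a
    ... | no _ = inj₁ (n , a)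
    incl : ∀ x y → ρ (h x) (h y) → Levelled R (suc N) x y
    incl (n , a) (n' , a') r with n ℕ.≟ N | n' ℕ.≟ N
    ... | yes e | yes e' = inj₁ (trans e (sym e') , r)
    ... | no ne | no ne' = case r
      where
      case : Levelled R N (n , a) (n' , a') → Levelled R (suc N) (n , a) (n' , a')
      case (inj₁ x) = inj₁ x
      case (inj₂ N≤n) = inj₂ (ℕP.≤∧≢⇒< N≤n (λ e → ne (sym e)))
    ... | yes _ | no _ = ⊥-elim r
    ... | no _ | yes _ = ⊥-elim r

  Prod : Rel₀ A → Rel₀ (ℕ × A)
  Prod R (n , a) (n' , a') = n ≤ n' × R a a'

  -- After (n0 , a0), pairs with first component ≥ n0 are handled by R ↑ a0, and the
  -- finitely many levels below n0 by af-levels.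
  af-prod : ∀ {R : Rel₀ A} → AF R → AF (Prod R)
  af-prod (now r) = af-mono (λ { (n , a) (n' , a') le → le , r a a' }) (af-comap proj₁ af-ℕ)
  af-prod {R} (later r) = later λ (n0 , a0) →
    af-mono (incl n0 a0) (af-comap (h n0) (af-sum (af-prod (r a0)) (af-levels (later r) n0) (ρ n0 a0) (λ x y z → z) (λ x y z → z)))
    where
    ρ : ℕ → A → Rel₀ ((ℕ × A) ⊎ (ℕ × A))
    ρ n0 a0 (inj₁ y) (inj₁ z) = Prod (R ↑ a0) y z
    ρ n0 a0 (inj₂ y) (inj₂ z) = Levelled R n0 y z
    ρ n0 a0 _ _ = ⊥
    h : ℕ → ℕ × A → (ℕ × A) ⊎ (ℕ × A)
    h n0 (n , a) with n0 ℕ.≤? n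
    ... | yes _ = inj₁ (n , a)
    ... | no _ = inj₂ (n , a)
    incl : ∀ n0 a0 x y → ρ n0 a0 (h n0 x) (h n0 y) → (Prod R ↑ (n0 , a0)) x y
    incl n0 a0 (n , a) (n' , a') r with n0 ℕ.≤? n | n0 ℕ.≤? n'
    ... | yes le | yes _ = case r
      where
      case : Prod (R ↑ a0) (n , a) (n' , a') → (Prod R ↑ (n0 , a0)) (n , a) (n' , a')
      case (le' , inj₁ x) = inj₁ (le' , x)
      case (le' , inj₂ x) = inj₂ (le , x)
    ... | yes le | no _ = ⊥-elim r
    ... | no _ | yes _ = ⊥-elim r
    ... | no nle | no _ = case r
      where
      case : Levelled R n0 (n , a) (n' , a') → (Prod R ↑ (n0 , a0)) (n , a) (n' , a')
      case (inj₁ (refl , x)) = inj₁ (ℕP.≤-refl , x)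
      case (inj₂ le) = ⊥-elim (nle le)

dickson : ∀ n → AF (_∣ᵐ_ {n})
dickson zero = now (λ { [] [] → [] })
dickson (suc n) = af-mono incl (af-comap split (af-prod (dickson n)))
  where
  split : Vec ℕ (suc n) → ℕ × Vec ℕ n
  split (x ∷ xs) = x , xs
  incl : ∀ u v → Prod _∣ᵐ_ (split u) (split v) → u ∣ᵐ v
  incl (x ∷ xs) (y ∷ ys) (le , pw) = le ∷ pw

af⇒acc : ∀ {A : Set} {R : Rel₀ A} → AF R → (T : Rel₀ A) → (∀ {x y z} → T x y → T y z → T x z) →
  (∀ {x y} → T y x → ¬ R x y) → ∀ x → Acc T x
af⇒acc (now h) T tr dis x = acc (λ {y} y<x → ⊥-elim (dis y<x (h x y)))
af⇒acc {R = R} (later h) T tr dis x = acc (λ {y} y<x → restrict y<x (af⇒acc (h x) Tx trx disx y))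
  where
  Tx : Rel₀ _
  Tx a b = T a b × T b x
  trx : ∀ {a b c} → Tx a b → Tx b c → Tx a c
  trx (ab , bx) (bc , cx) = tr ab bc , cx
  disx : ∀ {a b} → Tx b a → ¬ (R ↑ x) a b
  disx (ba , ax) (inj₁ r) = dis ba r
  disx (ba , ax) (inj₂ r) = dis ax r
  restrict : ∀ {y} → T y x → Acc Tx y → Acc T y
  restrict y<x (acc r) = acc (λ {z} z<y → restrict (tr z<y y<x) (r (z<y , y<x)))

module _ {n : ℕ} where
  private
    P : Set
    P = Poly n

  coeff-+ : ∀ (p q : P) u → coeff (p +ₚ q) u ≡ coeff p u +ℚ coeff q u
  coeff-+ p q u = trans (coeff≡pair (p +ₚ q) u) (trans (pair-++ (indicator u) p q) (sym (cong₂ _+ℚ_ (coeff≡pair p u) (coeff≡pair q u))))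

  coeff-neg : ∀ (p : P) u → coeff (-ₚ p) u ≡ -ℚ coeff p u
  coeff-neg p u = trans (coeff≡pair (-ₚ p) u) (trans (pair-neg (indicator u) p) (cong -ℚ_ (sym (coeff≡pair p u))))

  coeff-const-*ₚ : ∀ c (p : P) u → coeff (const c *ₚ p) u ≡ c *ℚ coeff p u
  coeff-const-*ₚ c p u = trans (coeff≡pair (const c *ₚ p) u) (trans (pair-const-*ₚ (indicator u) c p) (cong (c *ℚ_) (sym (coeff≡pair p u))))

  coeff-monomial : ∀ (v u : Mon n) → coeff (monomial v) u ≡ δ v u 1ℚ
  coeff-monomial v u = trans (coeff≡pair (monomial v) u) (trans (ℚP.+-identityʳ _) (ℚP.*-identityˡ _))

  InSupp? : ∀ (p : P) u → Dec (InSupp u p)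
  InSupp? p u = ¬? (coeff p u ℚ.≟ 0ℚ)

  ¬InSupp⇒≡0 : ∀ {p : P} {u} → ¬ InSupp u p → coeff p u ≡ 0ℚ
  ¬InSupp⇒≡0 {p} {u} = decidable-stable (coeff p u ℚ.≟ 0ℚ)

  InSupp-≋ : ∀ {p q : P} {u} → p ≋ q → InSupp u p → InSupp u q
  InSupp-≋ {u = u} e s z = s (trans (get e u) z)

  InSupp-+ : ∀ (p q : P) {u} → InSupp u (p +ₚ q) → InSupp u p ⊎ InSupp u q
  InSupp-+ p q {u} s with InSupp? p u | InSupp? q u
  ... | yes sp | _ = inj₁ sp
  ... | no _ | yes sq = inj₂ sq
  ... | no ¬sp | no ¬sq = ⊥-elim (s (trans (coeff-+ p q u) (trans (cong₂ _+ℚ_ (¬InSupp⇒≡0 {p} ¬sp) (¬InSupp⇒≡0 {q} ¬sq)) (ℚP.+-identityˡ 0ℚ))))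

  InSupp-neg : ∀ (p : P) {u} → InSupp u (-ₚ p) → InSupp u p
  InSupp-neg p {u} s z = s (trans (coeff-neg p u) (cong -ℚ_ z))

  InSupp-const-*ₚ : ∀ c (p : P) {u} → InSupp u (const c *ₚ p) → InSupp u p
  InSupp-const-*ₚ c p {u} s z = s (trans (coeff-const-*ₚ c p u) (trans (cong (c *ℚ_) z) (ℚP.*-zeroʳ c)))

  InSupp-monomial : ∀ {u v : Mon n} → InSupp u (monomial v) → v ≡ u
  InSupp-monomial {u} {v} s = decidable-stable (v ≟ᵐ u) (λ v≢u → s (trans (coeff-monomial v u) (δ-≢ 1ℚ v≢u)))

  monomials : P → List (Mon n)
  monomials = map proj₂

  InSupp⇒∈monomials : ∀ (p : P) {u} → InSupp u p → u ∈ monomials p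
  InSupp⇒∈monomials [] s = ⊥-elim (s refl)
  InSupp⇒∈monomials ((c , v) ∷ p) {u} s with v ≟ᵐ u
  ... | yes refl = here refl
  ... | no _ = there (InSupp⇒∈monomials p s)

  findInSupp : ∀ (Q : Mon n → Set) → Decidable Q → (p : P) → (∃[ v ] InSupp v p × Q v) ⊎ (∀ v → InSupp v p → ¬ Q v)
  findInSupp Q Q? p with any? (λ v → InSupp? p v ×-dec Q? v) (monomials p)
  ... | yes found = let v , _ , sq = find found in inj₁ (v , sq)
  ... | no none = inj₂ (λ v s q → none (lose (InSupp⇒∈monomials p s) (s , q)))

  isZero? : ∀ (p : P) → IsZero p ⊎ (∃[ v ] InSupp v p)
  isZero? p with findInSupp (λ _ → ⊤) (λ _ → yes tt) p
  ... | inj₁ (v , s , _) = inj₂ (v , s)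
  ... | inj₂ h = inj₁ (λ u → ¬InSupp⇒≡0 {p} (λ s → h u s tt))

InSupp-mapMon : ∀ {a b} (φ : Mon a → Mon b) (q : Poly a) {u} → InSupp u (mapMon φ q) → ∃[ v ] InSupp v q × φ v ≡ u
InSupp-mapMon φ q {u} s with findInSupp (λ v → φ v ≡ u) (λ v → φ v ≟ᵐ u) q
... | inj₁ found = found
... | inj₂ none = ⊥-elim (s (begin
  coeff (mapMon φ q) u         ≡⟨ coeff≡pair (mapMon φ q) u ⟩
  pair (indicator u) (mapMon φ q) ≡⟨ pair-mapMon _ φ q ⟩
  pair (indicator u ∘ φ) q     ≡⟨ pair-supp _ (λ _ → 0ℚ) q (λ v sv → δ-≢ 1ℚ (none v sv)) ⟩
  pair (λ _ → 0ℚ) q            ≡⟨ pair-zeroˡ q ⟩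
  0ℚ                           ∎))
  where open ≡-Reasoning

module LeadingMonomial {n : ℕ} (_≼_ : Mon n → Mon n → Set) (≼-total : ∀ u v → (u ≼ v) ⊎ (v ≼ u))
                       (≼-trans : ∀ {u v w} → u ≼ v → v ≼ w → u ≼ w) (≼-refl : ∀ {u} → u ≼ u) where

  maximum : (x : Mon n) (xs : List (Mon n)) → ∃[ y ] (y ≡ x ⊎ y ∈ xs) × (x ≼ y) × All (_≼ y) xs
  maximum x [] = x , inj₁ refl , ≼-refl , []
  maximum x (z ∷ xs) with maximum x xs
  ... | y , y∈ , x≼y , xs≼y with ≼-total z y
  ...   | inj₁ z≼y = y , [ inj₁ , inj₂ ∘ there ]′ y∈ , x≼y , z≼y ∷ xs≼y
  ...   | inj₂ y≼z = z , inj₂ (here refl) , ≼-trans x≼y y≼z , ≼-refl ∷ All.map (λ a → ≼-trans a y≼z) xs≼y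

  leading : ∀ (p : Poly n) u → InSupp u p → ∃[ l ] InSupp l p × (∀ v → InSupp v p → v ≼ l)
  leading p u su with maximum u (L.filter (InSupp? p) (monomials p))
  ... | y , y∈ , _ , below = y , inSupp y∈ , λ v sv → All.lookup below (∈-filter⁺ (InSupp? p) (InSupp⇒∈monomials p sv) sv)
    where
    inSupp : ∀ {y} → y ≡ u ⊎ y ∈ L.filter (InSupp? p) (monomials p) → InSupp y p
    inSupp (inj₁ refl) = su
    inSupp (inj₂ i) = proj₂ (∈-filter⁻ (InSupp? p) {xs = monomials p} i)

∣ᵐ⇒*ᵐ : ∀ {n} {u v : Mon n} → u ∣ᵐ v → ∃[ w ] v ≡ u *ᵐ w
∣ᵐ⇒*ᵐ [] = [] , refl
∣ᵐ⇒*ᵐ {u = x ∷ u} {y ∷ v} (x≤y ∷ u∣v) with ∣ᵐ⇒*ᵐ u∣v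
... | w , refl = (y ℕ.∸ x) ∷ w , cong (_∷ (u *ᵐ w)) (sym (ℕP.m+[n∸m]≡n x≤y))

∣ᵐ-*ᵐ : ∀ {n} (u w : Mon n) → w ∣ᵐ (u *ᵐ w)
∣ᵐ-*ᵐ [] [] = []
∣ᵐ-*ᵐ (x ∷ u) (y ∷ w) = ℕP.m≤n+m y x ∷ ∣ᵐ-*ᵐ u w

*ᵐ-cancelˡ : ∀ {n} (w u v : Mon n) → w *ᵐ u ≡ w *ᵐ v → u ≡ v
*ᵐ-cancelˡ [] [] [] e = refl
*ᵐ-cancelˡ (x ∷ w) (a ∷ u) (b ∷ v) e = cong₂ _∷_ (ℕP.+-cancelˡ-≡ x a b (cong V.head e)) (*ᵐ-cancelˡ w u v (cong V.tail e))

OverY : ∀ m {k} → Mon (m + k) → Set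
OverY m u = take m u ≡ replicate m 0

OverY? : ∀ m {k} (u : Mon (m + k)) → Dec (OverY m u)
OverY? m u = take m u ≟ᵐ replicate m 0

∣ᵐ-OverY : ∀ m {k} {a b : Mon (m + k)} → a ∣ᵐ b → OverY m b → OverY m a
∣ᵐ-OverY zero _ _ = refl
∣ᵐ-OverY (suc m) {a = x ∷ a} {y ∷ b} (x≤y ∷ a∣b) e =
  cong₂ _∷_ (ℕP.n≤0⇒n≡0 (subst (x ≤_) (cong V.head e) x≤y)) (∣ᵐ-OverY m a∣b (cong V.tail e))

OverY-*ᵐ : ∀ m {k} (u v : Mon (m + k)) → OverY m u → OverY m v → OverY m (u *ᵐ v)
OverY-*ᵐ m u v u∈Y v∈Y = trans (VP.take-zipWith _+_ u v) (trans (cong₂ _*ᵐ_ u∈Y v∈Y) (*ᵐ-identityˡ (replicate m 0)))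

module Elimination (m k : ℕ) (ord : MonomialOrder (m + k)) where
  open MonomialOrder ord
  open IsTotalOrder isTotalOrder using (antisym; total; reflexive) renaming (trans to ≼-trans)

  private
    M : Set
    M = Mon (m + k)

  ≼-refl : ∀ {u : M} → u ≼ u
  ≼-refl = reflexive refl

  _≺_ : M → M → Set
  u ≺ v = (u ≼ v) × (u ≢ v)

  ≺-trans : ∀ {x y z} → x ≺ y → y ≺ z → x ≺ z
  ≺-trans (x≼y , x≢y) (y≼z , _) = ≼-trans x≼y y≼z , λ { refl → x≢y (antisym x≼y y≼z) }

  ∣ᵐ⇒≼ : ∀ {u v : M} → u ∣ᵐ v → u ≼ v
  ∣ᵐ⇒≼ {u} u∣v with ∣ᵐ⇒*ᵐ u∣v
  ... | w , refl = subst₂ _≼_ (*ᵐ-identityˡ u) (*ᵐ-comm w u) (multiplicative 1ᵐ w u (one-least w))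

  ≺-acc : ∀ u → Acc _≺_ u
  ≺-acc = af⇒acc (dickson (m + k)) _≺_ ≺-trans (λ (y≼x , y≢x) x∣y → y≢x (antisym y≼x (∣ᵐ⇒≼ x∣y)))

  embYᵐ-drop : ∀ (u : M) → OverY m u → embYᵐ m (drop m u) ≡ u
  embYᵐ-drop u u∈Y = trans (cong (_++ drop m u) (sym u∈Y)) (VP.take++drop≡id m u)

  elimY⇒≼ : ∀ {u v : M} → OverY m u → OverY m v → elimY m ord u v → u ≼ v
  elimY⇒≼ u∈Y v∈Y (inj₁ (_ , neq)) = ⊥-elim (neq (cong (embXᵐ k) (trans u∈Y (sym v∈Y))))
  elimY⇒≼ {u} {v} u∈Y v∈Y (inj₂ (_ , u≼v)) = subst₂ _≼_ (embYᵐ-drop u u∈Y) (embYᵐ-drop v v∈Y) u≼v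

  ≼⇒elimY : ∀ {u v : M} → OverY m u → OverY m v → u ≼ v → elimY m ord u v
  ≼⇒elimY {u} {v} u∈Y v∈Y u≼v = inj₂ (trans u∈Y (sym v∈Y) , subst₂ _≼_ (sym (embYᵐ-drop u u∈Y)) (sym (embYᵐ-drop v v∈Y)) u≼v)

  -- The elimination property: every X-part is ≽ 1, so if the ≼_Y-leading monomial
  -- of g is free of X, then so is every monomial of g.
  leading-OverY⇒InQY : ∀ {g lg} → OverY m lg → IsLM (elimY m ord) g lg → InQY m g
  leading-OverY⇒InQY {g} {lg} lg∈Y (_ , below) u su with below u su
  ... | inj₂ (same-X , _) = trans same-X lg∈Y
  ... | inj₁ (x≼1 , x≢1) = ⊥-elim (x≢1 (antisym x≼1
        (subst (_≼ embXᵐ k (take m u)) (trans (sym (replicate-++ m k)) (cong (embXᵐ k) (sym lg∈Y))) (one-least _))))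

  open LeadingMonomial _≼_ total ≼-trans ≼-refl public

module _ {n : ℕ} (_≼_ : MonRel n) (G : List (Poly n)) where

  Irreducibleᵐ : Mon n → Set
  Irreducibleᵐ u = ∀ g lg → g ∈ G → IsLM _≼_ g lg → ¬ (lg ∣ᵐ u)

  Irreducibleₚ : Poly n → Set
  Irreducibleₚ r = ∀ u → InSupp u r → Irreducibleᵐ u

  IsNormalForm⇒Irreducibleₚ : ∀ {p r} → IsNormalForm _≼_ G p r → Irreducibleₚ r
  IsNormalForm⇒Irreducibleₚ (_ , irr) u su g lg g∈G lm = irr g lg u g∈G lm su

  Irreducibleₚ-closed : ConeClosed Irreducibleₚ
  Irreducibleₚ-closed = record
    { closed-≋ = λ e irr u s → irr u (InSupp-≋ (≋-sym e) s)
    ; closed-0 = λ u s → ⊥-elim (s refl)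
    ; closed-+ = λ {p} {q} irr-p irr-q u s → [ irr-p u , irr-q u ]′ (InSupp-+ p q s)
    ; closed-scale = λ c _ {p} irr u s → irr u (InSupp-const-*ₚ c p s) }

  -- Irreducible polynomials congruent modulo the ideal are equal: their difference
  -- would otherwise have a leading monomial divisible by one of G.
  Irreducibleₚ-unique : ∀ {S r s} → IsGroebnerOf _≼_ S G → Irreducibleₚ r → Irreducibleₚ s → InIdeal S (r -ₚ s) → r ≋ s
  Irreducibleₚ-unique {r = r} {s} (_ , groebner) irr-r irr-s r-s∈S = begin
    r                ≈⟨ solve 2 (λ r s → r := (r :- s) :+ s) ≋-refl r s ⟩
    (r -ₚ s) +ₚ s    ≈⟨ +ₚ-cong (mk≋ {p = r -ₚ s} {q = 0ₚ} r-s≈0) (≋-refl {p = s}) ⟩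
    0ₚ +ₚ s          ≈⟨ +ₚ-identityˡ s ⟩
    s                ∎
    where
    open import Relation.Binary.Reasoning.Setoid (CommutativeRing.setoid (PolyRing n))
    open PolySolver n
    r-s≈0 : IsZero (r -ₚ s)
    r-s≈0 u = ¬InSupp⇒≡0 {p = r -ₚ s} λ su → contradiction (groebner (r -ₚ s) r-s∈S (λ z → su (z u)))
      where
      contradiction : (∃[ g ] ∃[ lp ] ∃[ lg ] (g ∈ G × IsLM _≼_ (r -ₚ s) lp × IsLM _≼_ g lg × lg ∣ᵐ lp)) → ⊥
      contradiction (g , lp , lg , g∈G , (slp , _) , lm , lg∣lp) =
        [ (λ sr → irr-r lp sr g lg g∈G lm lg∣lp) , (λ ss → irr-s lp (InSupp-neg s ss) g lg g∈G lm lg∣lp) ]′ (InSupp-+ r (-ₚ s) slp)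

module Reduction (m k : ℕ) (ord : MonomialOrder (m + k)) (G : List (Poly (m + k))) where
  open Elimination m k ord
  open MonomialOrder ord
  open PolySolver (m + k)

  private
    M : Set
    M = Mon (m + k)
    P : Set
    P = Poly (m + k)

  G∩ℚ[Y] : PSet (m + k)
  G∩ℚ[Y] g = g ∈ G × InQY m g

  Irreducible : M → Set
  Irreducible = Irreducibleᵐ (elimY m ord) G

  InNormalForm : P → Set
  InNormalForm = Irreducibleₚ (elimY m ord) G

  ReducibleBy : M → P → Set
  ReducibleBy u g = ∃[ lg ] IsLM (elimY m ord) g lg × lg ∣ᵐ u

  InQY? : ∀ (g : P) → InQY m g ⊎ (∃[ v ] InSupp v g × ¬ OverY m v)
  InQY? g with findInSupp (¬_ ∘ OverY m) (¬? ∘ OverY? m) g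
  ... | inj₁ found = inj₂ found
  ... | inj₂ none = inj₁ (λ v s → decidable-stable (OverY? m v) (none v s))

  -- A leading monomial dividing a monomial over Y is over Y, so only elements of
  -- G ∩ ℚ[Y] can reduce a monomial over Y; for those ≼_Y agrees with ≼ and the
  -- leading monomial is computable.
  reducibleBy? : ∀ u → OverY m u → ∀ g → Dec (ReducibleBy u g)
  reducibleBy? u u∈Y g with InQY? g
  ... | inj₂ (v , sv , v∉Y) = no λ (lg , lm , lg∣u) → v∉Y (leading-OverY⇒InQY {g} (∣ᵐ-OverY m lg∣u u∈Y) lm v sv)
  ... | inj₁ g∈ℚ[Y] with isZero? g
  ...   | inj₁ g≈0 = no λ (lg , (slg , _) , _) → slg (g≈0 lg)
  ...   | inj₂ (v , sv) with leading g v sv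
  ...     | l , sl , below with PW.decidable ℕ._≤?_ l u
  ...       | yes l∣u = yes (l , (sl , λ w sw → ≼⇒elimY (g∈ℚ[Y] w sw) (g∈ℚ[Y] l sl) (below w sw)) , l∣u)
  ...       | no l∤u = no λ (lg , (slg , below′) , lg∣u) → l∤u (subst (_∣ᵐ u) (antisym
                (elimY⇒≼ (g∈ℚ[Y] lg slg) (g∈ℚ[Y] l sl) (≼⇒elimY (g∈ℚ[Y] lg slg) (g∈ℚ[Y] l sl) (below lg slg)))
                (elimY⇒≼ (g∈ℚ[Y] l sl) (g∈ℚ[Y] lg slg) (below′ l sl))) lg∣u)
    where open IsTotalOrder isTotalOrder using (antisym)

  irreducible? : ∀ u → OverY m u → Irreducible u ⊎ (∃[ g ] g ∈ G × ReducibleBy u g)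
  irreducible? u u∈Y with any? (reducibleBy? u u∈Y) G
  ... | yes found = inj₂ (find found)
  ... | no none = inj₁ (λ g lg g∈G lm lg∣u → none (lose g∈G (lg , lm , lg∣u)))

  Reduct : P → Set
  Reduct p = ∃[ r ] InQY m r × InNormalForm r × Ideal G∩ℚ[Y] (p -ₚ r)

  Reduct-0 : ∀ p → IsZero p → Reduct p
  Reduct-0 p p≈0 = 0ₚ , (λ _ s → ⊥-elim (s refl)) , (λ _ s → ⊥-elim (s refl)) ,
    Ideal-≋ (≋-sym (≋-trans (+ₚ-identityʳ p) (mk≋ {p = p} {q = 0ₚ} p≈0))) Ideal-0

  cancel-leading : ∀ (p X : P) a lp → InQY m p → InQY m X → (∀ v → InSupp v p → v ≼ lp) → (∀ v → InSupp v X → v ≼ lp) →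
    a *ℚ coeff X lp ≡ coeff p lp → InQY m (p -ₚ (const a *ₚ X)) × (∀ u → InSupp u (p -ₚ (const a *ₚ X)) → u ≺ lp)
  cancel-leading p X a lp p∈ℚ[Y] X∈ℚ[Y] p≼lp X≼lp same-lead = (λ u s → [ p∈ℚ[Y] u , X∈ℚ[Y] u ]′ (either s)) ,
    (λ u s → [ p≼lp u , X≼lp u ]′ (either s) , λ { refl → s lead-cancels })
    where
    either : ∀ {u} → InSupp u (p -ₚ (const a *ₚ X)) → InSupp u p ⊎ InSupp u X
    either s with InSupp-+ p (-ₚ (const a *ₚ X)) s
    ... | inj₁ sp = inj₁ sp
    ... | inj₂ sX = inj₂ (InSupp-const-*ₚ a X (InSupp-neg (const a *ₚ X) sX))
    lead-cancels : coeff (p -ₚ (const a *ₚ X)) lp ≡ 0ℚ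
    lead-cancels = begin
      coeff (p -ₚ (const a *ₚ X)) lp        ≡⟨ coeff-+ p (-ₚ (const a *ₚ X)) lp ⟩
      coeff p lp +ℚ coeff (-ₚ (const a *ₚ X)) lp ≡⟨ cong (coeff p lp +ℚ_) (trans (coeff-neg (const a *ₚ X) lp) (cong -ℚ_ (coeff-const-*ₚ a X lp))) ⟩
      coeff p lp +ℚ -ℚ (a *ℚ coeff X lp)    ≡⟨ cong (λ z → coeff p lp +ℚ -ℚ z) same-lead ⟩
      coeff p lp +ℚ -ℚ coeff p lp           ≡⟨ ℚP.+-inverseʳ (coeff p lp) ⟩
      0ℚ                                    ∎
      where open ≡-Reasoning

  coeff-monomial-*ₚ : ∀ (w v : M) (g : P) → coeff (monomial w *ₚ g) (w *ᵐ v) ≡ coeff g v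
  coeff-monomial-*ₚ w v g = begin
    coeff (monomial w *ₚ g) (w *ᵐ v)                         ≡⟨ coeff≡pair (monomial w *ₚ g) (w *ᵐ v) ⟩
    pair (indicator (w *ᵐ v)) (monomial w *ₚ g)              ≡⟨ trans (pair-*ₚ _ (monomial w) g) (trans (ℚP.+-identityʳ _) (ℚP.*-identityˡ _)) ⟩
    pair (λ v′ → indicator (w *ᵐ v) (w *ᵐ v′)) g              ≡⟨ pair-ext g shift ⟩
    pair (indicator v) g                                     ≡⟨ coeff≡pair g v ⟨
    coeff g v                                                ∎
    where
    open ≡-Reasoning
    shift : ∀ v′ → indicator (w *ᵐ v) (w *ᵐ v′) ≡ indicator v v′
    shift v′ with v′ ≟ᵐ v
    ... | yes refl = δ-≡ (w *ᵐ v) 1ℚ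
    ... | no v′≢v = δ-≢ 1ℚ (v′≢v ∘ *ᵐ-cancelˡ w v′ v)

  InSupp-monomial-*ₚ : ∀ (w : M) (g : P) {u} → InSupp u (monomial w *ₚ g) → ∃[ v ] InSupp v g × w *ᵐ v ≡ u
  InSupp-monomial-*ₚ w g {u} s with findInSupp (λ v → w *ᵐ v ≡ u) (λ v → (w *ᵐ v) ≟ᵐ u) g
  ... | inj₁ found = found
  ... | inj₂ none = ⊥-elim (s (begin
    coeff (monomial w *ₚ g) u                 ≡⟨ coeff≡pair (monomial w *ₚ g) u ⟩
    pair (indicator u) (monomial w *ₚ g)      ≡⟨ trans (pair-*ₚ _ (monomial w) g) (trans (ℚP.+-identityʳ _) (ℚP.*-identityˡ _)) ⟩
    pair (λ v → indicator u (w *ᵐ v)) g        ≡⟨ pair-supp _ (λ _ → 0ℚ) g (λ v sv → δ-≢ 1ℚ (none v sv)) ⟩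
    pair (λ _ → 0ℚ) g                         ≡⟨ pair-zeroˡ g ⟩
    0ℚ                                        ∎))
    where open ≡-Reasoning

  Smaller : P → M → Set
  Smaller p lp = ∃[ p′ ] InQY m p′ × (∀ u → InSupp u p′ → u ≺ lp) × (Reduct p′ → Reduct p)

  -- An irreducible leading term moves into the remainder.
  remove-leading : ∀ p lp → InQY m p → InSupp lp p → (∀ v → InSupp v p → v ≼ lp) → Irreducible lp → Smaller p lp
  remove-leading p lp p∈ℚ[Y] slp below irr = p′ , smaller .proj₁ , smaller .proj₂ , back
    where
    c : ℚ
    c = coeff p lp
    t : P
    t = const c *ₚ monomial lp
    p′ : P
    p′ = p -ₚ t
    smaller : InQY m p′ × (∀ u → InSupp u p′ → u ≺ lp)
    smaller = cancel-leading p (monomial lp) c lp p∈ℚ[Y] (λ u s → subst (OverY m) (InSupp-monomial s) (p∈ℚ[Y] lp slp)) below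
                (λ v s → subst (_≼ lp) (InSupp-monomial s) ≼-refl) (trans (cong (c *ℚ_) (trans (coeff-monomial lp lp) (δ-≡ lp 1ℚ))) (ℚP.*-identityʳ c))
    in-t : ∀ {u} → InSupp u t → lp ≡ u
    in-t s = InSupp-monomial (InSupp-const-*ₚ c (monomial lp) s)
    back : Reduct p′ → Reduct p
    back (r , r∈ℚ[Y] , r-nf , p′-r∈) = r +ₚ t , r+t∈ℚ[Y] , r+t-nf ,
      Ideal-≋ (solve 3 (λ p t r → (p :- t) :- r := p :- (r :+ t)) ≋-refl p t r) p′-r∈
      where
      r+t∈ℚ[Y] : InQY m (r +ₚ t)
      r+t∈ℚ[Y] u s = [ r∈ℚ[Y] u , (λ st → subst (OverY m) (in-t st) (p∈ℚ[Y] lp slp)) ]′ (InSupp-+ r t s)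
      r+t-nf : InNormalForm (r +ₚ t)
      r+t-nf u s = [ r-nf u , (λ st → subst Irreducible (in-t st) irr) ]′ (InSupp-+ r t s)

  -- A reducible leading term is cancelled by a multiple of the reducer g, which lies in ℚ[Y].
  cancel-by : ∀ p lp → InQY m p → InSupp lp p → (∀ v → InSupp v p → v ≼ lp) → ∀ g → g ∈ G → ReducibleBy lp g → Smaller p lp
  cancel-by p lp p∈ℚ[Y] slp below g g∈G (lg , lm@(slg , g-below) , lg∣lp) = p′ , smaller .proj₁ , smaller .proj₂ , back
    where
    lp∈Y : OverY m lp
    lp∈Y = p∈ℚ[Y] lp slp
    lg∈Y : OverY m lg
    lg∈Y = ∣ᵐ-OverY m lg∣lp lp∈Y
    g∈ℚ[Y] : InQY m g
    g∈ℚ[Y] = leading-OverY⇒InQY {g} lg∈Y lm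
    w : M
    w = proj₁ (∣ᵐ⇒*ᵐ lg∣lp)
    lp≡lg*w : lp ≡ lg *ᵐ w
    lp≡lg*w = proj₂ (∣ᵐ⇒*ᵐ lg∣lp)
    w∈Y : OverY m w
    w∈Y = ∣ᵐ-OverY m (subst (w ∣ᵐ_) (sym lp≡lg*w) (∣ᵐ-*ᵐ lg w)) lp∈Y
    X : P
    X = monomial w *ₚ g
    d : ℚ
    d = coeff g lg
    instance
      d≢0 : ℚ.NonZero d
      d≢0 = ℚ.≢-nonZero slg
    c a : ℚ
    c = coeff p lp
    a = c *ℚ ℚ.1/ d
    p′ : P
    p′ = p -ₚ (const a *ₚ X)
    X∈ℚ[Y] : InQY m X
    X∈ℚ[Y] u s with InSupp-monomial-*ₚ w g s
    ... | v , sv , refl = OverY-*ᵐ m w v w∈Y (g∈ℚ[Y] v sv)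
    X≼lp : ∀ u → InSupp u X → u ≼ lp
    X≼lp u s with InSupp-monomial-*ₚ w g s
    ... | v , sv , refl = subst₂ _≼_ (*ᵐ-comm v w) (sym lp≡lg*w) (multiplicative v lg w (elimY⇒≼ (g∈ℚ[Y] v sv) lg∈Y (g-below v sv)))
    smaller : InQY m p′ × (∀ u → InSupp u p′ → u ≺ lp)
    smaller = cancel-leading p X a lp p∈ℚ[Y] X∈ℚ[Y] below X≼lp (begin
      a *ℚ coeff X lp                   ≡⟨ cong (λ u → a *ℚ coeff X u) (trans lp≡lg*w (*ᵐ-comm lg w)) ⟩
      a *ℚ coeff X (w *ᵐ lg)            ≡⟨ cong (a *ℚ_) (coeff-monomial-*ₚ w lg g) ⟩
      (c *ℚ ℚ.1/ d) *ℚ d                ≡⟨ ℚP.*-assoc c (ℚ.1/ d) d ⟩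
      c *ℚ (ℚ.1/ d *ℚ d)                ≡⟨ cong (c *ℚ_) (ℚP.*-inverseˡ d) ⟩
      c *ℚ 1ℚ                           ≡⟨ ℚP.*-identityʳ c ⟩
      c                                 ∎)
      where open ≡-Reasoning
    back : Reduct p′ → Reduct p
    back (r , r∈ℚ[Y] , r-nf , p′-r∈) = r , r∈ℚ[Y] , r-nf ,
      Ideal-≋ (solve 4 (λ p a x r → ((p :- a :* x) :- r) :+ a :* x := p :- r) ≋-refl p (const a) X r)
        (Ideal-+ p′-r∈ (Ideal-≋ (*ₚ-assoc (const a) (monomial w) g) (Ideal-* (const a *ₚ monomial w) (Ideal-generator (g∈G , g∈ℚ[Y])))))

  reduce-leading : ∀ p lp → InQY m p → InSupp lp p → (∀ v → InSupp v p → v ≼ lp) → Smaller p lp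
  reduce-leading p lp p∈ℚ[Y] slp below with irreducible? lp (p∈ℚ[Y] lp slp)
  ... | inj₁ irr = remove-leading p lp p∈ℚ[Y] slp below irr
  ... | inj₂ (g , g∈G , reducible) = cancel-by p lp p∈ℚ[Y] slp below g g∈G reducible

  private
    Below : M → Set
    Below l = ∀ p → InQY m p → (∀ u → InSupp u p → u ≺ l) → Reduct p

    reduce-via : ∀ p → InQY m p → (∀ lp → InSupp lp p → Below lp) → Reduct p
    reduce-via p p∈ℚ[Y] rec with isZero? p
    ... | inj₁ p≈0 = Reduct-0 p p≈0
    ... | inj₂ (v , sv) with leading p v sv
    ...   | lp , slp , below with reduce-leading p lp p∈ℚ[Y] slp below
    ...     | p′ , p′∈ℚ[Y] , p′≺lp , back = back (rec lp slp p′ p′∈ℚ[Y] p′≺lp)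

    reduce-below : ∀ l → Acc _≺_ l → Below l
    reduce-below l (acc rs) p p∈ℚ[Y] ≺l = reduce-via p p∈ℚ[Y] (λ lp slp → reduce-below lp (rs (≺l lp slp)))

  reduce : ∀ p → InQY m p → Reduct p
  reduce p p∈ℚ[Y] = reduce-via p p∈ℚ[Y] (λ lp _ → reduce-below lp (≺-acc lp))

record AlgCone′ {n} (Z P : PSet n) (x : Poly n) : Set where
  constructor mkAlgCone
  field
    ideal-part cone-part : Poly n
    ideal : Ideal Z ideal-part
    cone : Cone P cone-part
    equation : x ≋ (ideal-part +ₚ cone-part)

AlgCone′⇒AlgCone : ∀ {n} {Z P : PSet n} {x} → AlgCone′ Z P x → AlgCone Z P x
AlgCone′⇒AlgCone (mkAlgCone a b i c e) = a , b , Ideal⇒InIdeal i , Cone⇒InCone c , get e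

AlgCone′-closed : ∀ {n} (Z P : PSet n) → ConeClosed (AlgCone′ Z P)
AlgCone′-closed {n} Z P = record
  { closed-≋ = λ e (mkAlgCone a b i c e′) → mkAlgCone a b i c (≋-trans (≋-sym e) e′)
  ; closed-0 = mkAlgCone 0ₚ 0ₚ Ideal-0 Cone-0 ≋-refl
  ; closed-+ = λ (mkAlgCone a b i c e) (mkAlgCone a′ b′ i′ c′ e′) → mkAlgCone (a +ₚ a′) (b +ₚ b′) (Ideal-+ i i′) (Cone-+ c c′)
      (≋-trans (+ₚ-cong e e′) (solve 4 (λ a b a′ b′ → (a :+ b) :+ (a′ :+ b′) := (a :+ a′) :+ (b :+ b′)) ≋-refl a b a′ b′))
  ; closed-scale = λ c c≥0 (mkAlgCone a b i cb e) → mkAlgCone (const c *ₚ a) (const c *ₚ b) (Ideal-* (const c) i) (Cone-scale c c≥0 cb)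
      (≋-trans (*ₚ-cong (≋-refl {p = const c}) e) (*ₚ-distribˡ (const c) a b)) }
  where open PolySolver n

Pointwise-∈ˡ : ∀ {A B : Set} {R : A → B → Set} {xs ys x} → Pointwise R xs ys → x ∈ xs → ∃[ y ] y ∈ ys × R x y
Pointwise-∈ˡ (r ∷ _) (here refl) = _ , here refl , r
Pointwise-∈ˡ (_ ∷ rs) (there x∈xs) = let y , y∈ys , r = Pointwise-∈ˡ rs x∈xs in y , there y∈ys , r

Pointwise-∈ʳ : ∀ {A B : Set} {R : A → B → Set} {xs ys y} → Pointwise R xs ys → y ∈ ys → ∃[ x ] x ∈ xs × R x y
Pointwise-∈ʳ (r ∷ _) (here refl) = _ , here refl , r
Pointwise-∈ʳ (_ ∷ rs) (there y∈ys) = let x , x∈xs , r = Pointwise-∈ʳ rs y∈ys in x , there x∈xs , r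

module InverseImage (m k : ℕ) (ord : MonomialOrder (m + k))
    (Z P : List (Poly m)) (f : Poly k → Poly m) (f-ringHom : IsRingHom f)
    (G : List (Poly (m + k))) (G-groebner : IsGroebnerOf (elimY m ord) (listSet (invHomGens m k f Z)) G)
    (R : List (Poly (m + k))) (R-normal : Pointwise (IsNormalForm (elimY m ord) G) (map (embX k) P) R)
    (Q : List (Poly (m + k))) (Q-proj : IsProj (listSet R) (InQY m) Q) where

  f-hom : IsPolyHom f
  f-hom = isRingHom⇒isPolyHom f-ringHom
  open XY m k
  open Substitution m k f f-hom
  open Reduction m k ord G using (G∩ℚ[Y]; Reduct; reduce)

  private
    I : PSet (m + k)
    I = listSet (invHomGens m k f Z)
    NormalForm : Poly (m + k) → Poly (m + k) → Set
    NormalForm = IsNormalForm (elimY m ord) G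

  G⊆I : ∀ {g} → g ∈ G → Ideal I g
  G⊆I g∈G = InIdeal⇒Ideal (All.lookup (proj₁ G-groebner) g∈G)

  reduct-of : ∀ {p} → p ∈ P → ∃[ r ] r ∈ R × NormalForm (embX k p) r
  reduct-of p∈P = Pointwise-∈ˡ R-normal (∈-map⁺ (embX k) p∈P)

  reduced-from : ∀ {r} → r ∈ R → ∃[ p ] p ∈ P × NormalForm (embX k p) r
  reduced-from r∈R with Pointwise-∈ʳ R-normal r∈R
  ... | x , x∈ , nf with ∈-map⁻ (embX k) x∈
  ...   | p , p∈P , refl = p , p∈P , nf

  f∘toY : ∀ g → InQY m g → f (toY m g) ≋ σ g
  f∘toY g g∈ℚ[Y] = ≋-trans (≋-sym (σ-embY (toY m g))) (IsPolyHom.h-cong σ-isPolyHom (embY-toY g g∈ℚ[Y]))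

  -- r ≡ embX p modulo I, and σ maps I into ⟨Z⟩ and embX p to p.
  σ-R : ∀ {r} → r ∈ R → AlgCone′ (listSet Z) (listSet P) (σ r)
  σ-R {r} r∈R with reduced-from r∈R
  ... | p , p∈P , (p-r∈I , _) = mkAlgCone (-ₚ σ (embX k p -ₚ r)) p
    (Ideal-neg (σ-Ideal Z (Ideal-mono G⊆I (InIdeal⇒Ideal {p = embX k p -ₚ r} p-r∈I))))
    (Cone-generator p∈P)
    (≋-trans (solve 2 (λ x y → x := (:- (y :- x)) :+ y) ≋-refl (σ r) (σ (embX k p)))
             (+ₚ-cong (-ₚ-cong (≋-sym (IsPolyHom-properties.h-- σ-isPolyHom (embX k p) r))) (σ-embX p)))
    where open PolySolver m

  forward : ∀ q → AlgCone (GroebnerY m G) (listSet (map (toY m) Q)) q → AlgCone (listSet Z) (listSet P) (f q)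
  forward q (a , b , a∈ , b∈ , q≈a+b) = AlgCone′⇒AlgCone (closed-≋ (≋-sym f[q]≋) (closed-+ f[a]∈ f[b]∈))
    where
    open ConeClosed (AlgCone′-closed (listSet Z) (listSet P))
    open IsPolyHom-properties f-hom using (Ideal-map; pullback-coneClosed)
    f[q]≋ : f q ≋ (f a +ₚ f b)
    f[q]≋ = ≋-trans (IsPolyHom.h-cong f-hom (mk≋ {p = q} {q = a +ₚ b} q≈a+b)) (IsPolyHom.h-+ f-hom a b)
    f[a]∈ : AlgCone′ (listSet Z) (listSet P) (f a)
    f[a]∈ = mkAlgCone (f a) 0ₚ (Ideal-map (λ { (g , g∈G , g∈ℚ[Y] , refl) → Ideal-≋ (≋-sym (f∘toY g g∈ℚ[Y])) (σ-Ideal Z (G⊆I g∈G)) })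
                                 (InIdeal⇒Ideal a∈))
                      Cone-0 (≋-sym (+ₚ-identityʳ (f a)))
    f[toY-Q] : ∀ {x} → x ∈ map (toY m) Q → AlgCone′ (listSet Z) (listSet P) (f x)
    f[toY-Q] x∈ with ∈-map⁻ (toY m) x∈
    ... | g , g∈Q , refl with Equivalence.to (Q-proj g) (Cone⇒InCone (Cone-generator g∈Q))
    ...   | g∈cone[R] , g∈ℚ[Y] = closed-≋ (≋-sym (f∘toY g g∈ℚ[Y]))
            (Cone-ind (IsPolyHom-properties.pullback-coneClosed σ-isPolyHom (AlgCone′-closed _ _)) σ-R (InCone⇒Cone {p = g} g∈cone[R]))
    f[b]∈ : AlgCone′ (listSet Z) (listSet P) (f b)
    f[b]∈ = Cone-ind (pullback-coneClosed (AlgCone′-closed _ _)) f[toY-Q] (InCone⇒Cone b∈)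

  record NormalConeRep (x : Poly m) : Set where
    constructor mkRep
    field
      rep : Poly (m + k)
      rep∈cone : Cone (listSet R) rep
      rep-irreducible : Irreducibleₚ (elimY m ord) G rep
      rep≡ : Ideal I (embX k x -ₚ rep)

  NormalConeRep-closed : ConeClosed NormalConeRep
  NormalConeRep-closed = record
    { closed-≋ = λ e (mkRep s c irr s≡) → mkRep s c irr (Ideal-≋ (+ₚ-cong (IsPolyHom.h-cong embX-isPolyHom e) (≋-refl {p = -ₚ s})) s≡)
    ; closed-0 = mkRep 0ₚ Cone-0 closed-0 (Ideal-≋ (≋-sym (-ₚ-inverseʳ 0ₚ)) Ideal-0)
    ; closed-+ = λ {x} {y} (mkRep s c irr s≡) (mkRep s′ c′ irr′ s′≡) → mkRep (s +ₚ s′) (Cone-+ c c′) (closed-+ {p = s} {q = s′} irr irr′)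
        (Ideal-≋ (≋-trans (solve 4 (λ a b c d → (a :- c) :+ (b :- d) := (a :+ b) :- (c :+ d)) ≋-refl (embX k x) (embX k y) s s′)
                          (+ₚ-cong (≋-sym (IsPolyHom.h-+ embX-isPolyHom x y)) (≋-refl {p = -ₚ (s +ₚ s′)})))
           (Ideal-+ s≡ s′≡))
    ; closed-scale = λ c c≥0 {x} (mkRep s cs irr s≡) → mkRep (const c *ₚ s) (Cone-scale c c≥0 cs) (closed-scale c c≥0 {p = s} irr)
        (Ideal-≋ (≋-trans (solve 3 (λ a x s → a :* (x :- s) := a :* x :- a :* s) ≋-refl (const c) (embX k x) s)
                          (+ₚ-cong (≋-sym (≋-trans (IsPolyHom.h-* embX-isPolyHom (const c) x)
                                                   (*ₚ-cong (IsPolyHom-properties.h-const embX-isPolyHom c) (≋-refl {p = embX k x}))))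
                                   (≋-refl {p = -ₚ (const c *ₚ s)})))
           (Ideal-* (const c) s≡)) }
    where
    open PolySolver (m + k)
    open ConeClosed (Irreducibleₚ-closed (elimY m ord) G)

  NormalConeRep-P : ∀ {p} → p ∈ P → NormalConeRep p
  NormalConeRep-P {p} p∈P with reduct-of p∈P
  ... | r , r∈R , nf@(p-r∈ , _) =
    mkRep r (Cone-generator r∈R) (IsNormalForm⇒Irreducibleₚ (elimY m ord) G {embX k p} nf) (Ideal-mono G⊆I (InIdeal⇒Ideal {p = embX k p -ₚ r} p-r∈))

  embY-InQY : ∀ q → InQY m (embY m {k} q)
  embY-InQY q u s with InSupp-mapMon (embYᵐ m) q s
  ... | v , _ , refl = take-++ m (replicate m 0) v

  -- With y = embY q ≡ embX (f q) ≡ s (mod I), the reduct r of y by G ∩ ℚ[Y] and s are both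
  -- irreducible, hence equal; so r ∈ cone(R) ∩ ℚ[Y] = cone(Q) and q = toY (y - r) + toY r.
  backward : ∀ q → AlgCone (listSet Z) (listSet P) (f q) → AlgCone (GroebnerY m G) (listSet (map (toY m) Q)) q
  backward q (a , b , a∈ , b∈ , f[q]≈a+b) =
    combine (Cone-ind NormalConeRep-closed NormalConeRep-P (InCone⇒Cone {p = b} b∈)) (reduce (embY m q) (embY-InQY q))
    where
    y : Poly (m + k)
    y = embY m q
    combine : NormalConeRep b → Reduct y → AlgCone (GroebnerY m G) (listSet (map (toY m) Q)) q
    combine (mkRep s s∈cone s-irr b≡s) (r , r∈ℚ[Y] , r-irr , y-r∈) =
      toY m (y -ₚ r) , toY m r , Ideal⇒InIdeal ideal-part , Cone⇒InCone cone-part , get q≋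
      where
      open PolySolver (m + k)
      y≡embX[f[q]] : Ideal I (y -ₚ embX k (f q))
      y≡embX[f[q]] = Ideal-≋ (+ₚ-cong (≋-refl {p = y}) (-ₚ-cong (IsPolyHom.h-cong embX-isPolyHom (σ-embY q)))) (embX∘σ-Ideal Z y)
      embX[f[q]]≡embX[b] : Ideal I (embX k (f q) -ₚ embX k b)
      embX[f[q]]≡embX[b] = Ideal-≋ embX[a]≋ (embX-Ideal Z (InIdeal⇒Ideal {p = a} a∈))
        where
        embX[a]≋ : embX k a ≋ (embX k (f q) -ₚ embX k b)
        embX[a]≋ = ≋-trans (solve 2 (λ A B → A := (A :+ B) :- B) ≋-refl (embX k a) (embX k b))
          (+ₚ-cong (≋-sym (≋-trans (IsPolyHom.h-cong embX-isPolyHom (mk≋ {p = f q} {q = a +ₚ b} f[q]≈a+b)) (IsPolyHom.h-+ embX-isPolyHom a b)))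
                   (≋-refl {p = -ₚ embX k b}))
      r≡s : Ideal I (r -ₚ s)
      r≡s = Ideal-diff-trans {a = r} {b = y} (Ideal-diff-sym {a = y} {b = r} (Ideal-mono (G⊆I ∘ proj₁) {p = y -ₚ r} y-r∈))
              (Ideal-diff-trans {a = y} {b = embX k b} (Ideal-diff-trans {a = y} {b = embX k (f q)} y≡embX[f[q]] embX[f[q]]≡embX[b]) b≡s)
      r≋s : r ≋ s
      r≋s = Irreducibleₚ-unique (elimY m ord) G {r = r} {s = s} G-groebner r-irr s-irr (Ideal⇒InIdeal r≡s)
      r∈cone[Q] : Cone (listSet Q) r
      r∈cone[Q] = InCone⇒Cone {p = r} (Equivalence.from (Q-proj r) (Cone⇒InCone {p = r} (Cone-≋ (≋-sym r≋s) s∈cone) , r∈ℚ[Y]))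
      cone-part : Cone (listSet (map (toY m) Q)) (toY m r)
      cone-part = Cone-ind (IsPolyHom-properties.pullback-coneClosed toY-isPolyHom Cone-closed) (Cone-generator ∘ ∈-map⁺ (toY m)) r∈cone[Q]
      ideal-part : Ideal (GroebnerY m G) (toY m (y -ₚ r))
      ideal-part = IsPolyHom-properties.Ideal-map toY-isPolyHom (λ { {g} (g∈G , g∈ℚ[Y]) → Ideal-generator (g , g∈G , g∈ℚ[Y] , refl) }) y-r∈
      q≋ : q ≋ (toY m (y -ₚ r) +ₚ toY m r)
      q≋ = ≋-trans (≋-sym (toY-embY q)) (≋-trans (IsPolyHom.h-cong toY-isPolyHom (solve 2 (λ y r → y := (y :- r) :+ r) ≋-refl y r))
                                               (IsPolyHom.h-+ toY-isPolyHom (y -ₚ r) r))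

theorem4p7 : (m k : ℕ) (ord : MonomialOrder (m + k))
    (Z P : List (Poly m)) → IsGroebner (restrictX ord) Z →
    (f : Poly k → Poly m) → IsRingHom f →
    -- G : Gröbner basis of ⟨{y - f(y)} ∪ Z⟩ in ℚ[X ∪ Y] w.r.t. ≼_Y
    (G : List (Poly (m + k))) →
    IsGroebnerOf (elimY m ord) (listSet (invHomGens m k f Z)) G →
    -- R = {red_G(p) : p ∈ P}
    (R : List (Poly (m + k))) →
    Pointwise (IsNormalForm (elimY m ord) G) (map (embX k) P) R →
    -- Q = proj(R, [Y])
    (Q : List (Poly (m + k))) → IsProj (listSet R) (InQY m) Q →
    -- alg.cone_Y(inverse-hom(Z,P,f,Y)) = f⁻¹(alg.cone_X(Z,P))
    (q : Poly k) →
    AlgCone (GroebnerY m G) (listSet (map (toY m) Q)) q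
      ⇔ AlgCone (listSet Z) (listSet P) (f q)
theorem4p7 m k ord Z P _ f f-hom G G-groebner R R-normal Q Q-proj q = mk⇔ (forward q) (backward q)
  where open InverseImage m k ord Z P f f-hom G G-groebner R R-normal Q Q-proj
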